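{- Let $M$ be a matroid on $[n]$ with rank function $r$, and let $[[M]]=\{(ij|K): K\subseteq[n],\ i\neq j\in[n]\setminus K,\ r(iK)+r(jK)=r(ijK)+r(K)\}$. For any $K\subseteq[n]$ and $i\neq j\in[n]\setminus K$ the following are equivalent: (1) $(ij|K)\notin[[M]]$; (2) $r(iK)=r(jK)=r(ijK)=r(K)+1$; (3) there exists a circuit $C$ of $M$ with $\{i,j\}\subseteq C\subseteq ijK$, and every circuit of $M$ contained in $ijK$ contains either both $i,j$ or neither of them; (4) $\{i,j\}$ is a cocircuit of the restriction $M|ijK$ (equivalently, $K$ is a hyperplane of $M|ijK$); (5) for every basis $B$ of $M|K$, both $iB$ and $jB$ are bases of $M|ijK$; (6) there exists a basis $B$ of $M|K$ such that $iB$ and $jB$ are bases of $M|ijK$; (7) for every ordering $k_1,\dots,k_s$ of $K$ and every ordering $\ell_1,\dots,\ell_{n-s-2}$ of $[n]\setminus ijK$, the cone $\{\mathbf{x}\in\mathbb{R}^n: x_{k_1}\ge\cdots\ge x_{k_s}\ge x_i=x_j\ge x_{\ell_1}\ge\cdots\ge x_{\ell_{n-s-2}}\}$ is contained in some codimension-one cone (wall) of the normal fan of the base polytope $\mathcal{P}_M=\operatorname{conv}\{\sum_{b\in B}\mathbf{e}_b: B \text{ a basis of } M\}\subseteq\mathbb{R}^n$.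
   Context: Notation: concatenation denotes disjoint union, e.g. $iK=\{i\}\cup K$, $ijK=\{i,j\}\cup K$, $iB=\{i\}\cup B$. $M|S$ denotes the restriction of $M$ to $S$. The cones in (7) are the walls of the permutohedral fan of $\mathbb{R}^n$ associated with $(ij|K)$. The normal fan of a polytope is the fan of its (outer) normal cones.
   Formalization: In condition (7), the points of the cone and of the walls of the normal fan of $\mathcal{P}_M$, and the functionals exposing its edges, are taken in ℚ^n rather than ℝ^n. -}

module Defs where

open import Data.Nat as ℕ using (ℕ; zero; suc; _+_)
open import Data.Fin using (Fin; zero; suc)
open import Data.Fin.Subset using (Subset; _∈_; _∉_; _⊆_; _∪_; _∩_; ⁅_⁆; ∁; ⊤; _-_; ∣_∣)
open import Data.Bool using (Bool; true; false; if_then_else_)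
open import Data.Vec using (Vec; []; _∷_)
open import Data.List using (List; []; _∷_; _++_)
import Data.List.Membership.Propositional as LM
open import Data.List.Relation.Unary.Unique.Propositional using (Unique)
open import Data.List.Relation.Unary.Linked using (Linked)
open import Data.Rational as ℚ using (ℚ; 0ℚ)
open import Data.Product using (Σ; _×_; ∃; ∃-syntax)
open import Data.Sum using (_⊎_)
open import Relation.Nullary using (¬_)
open import Relation.Binary.PropositionalEquality using (_≡_; _≢_)
open import Function using (_∘_)

record Matroid (n : ℕ) : Set where
  field
    r        : Subset n → ℕ
    r-bound  : ∀ A → r A ℕ.≤ ∣ A ∣
    r-mono   : ∀ A B → A ⊆ B → r A ℕ.≤ r B
    r-submod : ∀ A B → r (A ∪ B) + r (A ∩ B) ℕ.≤ r A + r B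

module _ {n : ℕ} (M : Matroid n) where
  open Matroid M

  Independent : Subset n → Set
  Independent A = r A ≡ ∣ A ∣

  Circuit : Subset n → Set
  Circuit C = (¬ Independent C) × (∀ e → e ∈ C → Independent (C - e))

  BasisOf : Subset n → Subset n → Set
  BasisOf S B = B ⊆ S × Independent B
              × (∀ e → e ∈ S → e ∉ B → ¬ Independent (B ∪ ⁅ e ⁆))

  Basis : Subset n → Set
  Basis = BasisOf ⊤

  -- cocircuit of M|S: a minimal subset of S meeting every basis of M|S
  MeetsAllBases : Subset n → Subset n → Set
  MeetsAllBases S D = ∀ B → BasisOf S B → ∃[ e ] (e ∈ D × e ∈ B)

  CocircuitOf : Subset n → Subset n → Set
  CocircuitOf S D = D ⊆ S × MeetsAllBases S D
                  × (∀ D′ → D′ ⊆ D → MeetsAllBases S D′ → D′ ≡ D)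

  FlatOf : Subset n → Subset n → Set
  FlatOf S H = H ⊆ S × (∀ e → e ∈ S → e ∉ H → r (H ∪ ⁅ e ⁆) ≡ suc (r H))

  HyperplaneOf : Subset n → Subset n → Set
  HyperplaneOf S H = FlatOf S H × suc (r H) ≡ r S

  InBracket : Fin n → Fin n → Subset n → Set
  InBracket i j K =
    r (⁅ i ⁆ ∪ K) + r (⁅ j ⁆ ∪ K) ≡ r (⁅ i ⁆ ∪ ⁅ j ⁆ ∪ K) + r K

-- Linear functionals on ℚ^n evaluated at indicator vectors:
-- weight x B = ⟨x , Σ_{b∈B} e_b⟩.

weight : ∀ {n} → (Fin n → ℚ) → Subset n → ℚ
weight x [] = 0ℚ
weight x (b ∷ B) = (if b then x zero else 0ℚ) ℚ.+ weight (x ∘ suc) B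

module _ {n : ℕ} (M : Matroid n) where

  -- The vertices of P_M are the indicator vectors of bases (distinct bases
  -- give distinct vertices).  An edge (1-dimensional face) of P_M is a face
  -- with exactly two vertices: bases B₁ ≢ B₂ such that some linear functional
  -- y attains its maximum over P_M exactly at e_{B₁}, e_{B₂}.
  Edge : Subset n → Subset n → Set
  Edge B₁ B₂ = Basis M B₁ × Basis M B₂ × B₁ ≢ B₂ ×
    Σ (Fin n → ℚ) λ y →
      weight y B₁ ≡ weight y B₂ ×
      (∀ B → Basis M B → weight y B ℚ.≤ weight y B₁) ×
      (∀ B → Basis M B → weight y B ≡ weight y B₁ → B ≡ B₁ ⊎ B ≡ B₂)

  -- Normal cone of the edge [e_{B₁}, e_{B₂}]: the walls (codimension-one
  -- cones) of the normal fan of P_M are exactly these cones.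
  InNormalConeOfEdge : Subset n → Subset n → (Fin n → ℚ) → Set
  InNormalConeOfEdge B₁ B₂ x =
    weight x B₁ ≡ weight x B₂ × (∀ B → Basis M B → weight x B ℚ.≤ weight x B₁)

  InCone : List (Fin n) → Fin n → Fin n → List (Fin n) → (Fin n → ℚ) → Set
  InCone ks i j ls x = Linked (λ a b → x b ℚ.≤ x a) (ks ++ i ∷ ls) × x i ≡ x j

  OrderingOf : Subset n → List (Fin n) → Set
  OrderingOf S ks = Unique ks × (∀ e → e ∈ S → e LM.∈ ks) × (∀ e → e LM.∈ ks → e ∈ S)

  ConeCondition : Fin n → Fin n → Subset n → Set
  ConeCondition i j K =
    ∀ ks ls → OrderingOf K ks → OrderingOf (∁ (⁅ i ⁆ ∪ ⁅ j ⁆ ∪ K)) ls →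
      ∃[ B₁ ] ∃[ B₂ ] (Edge B₁ B₂ ×
        (∀ x → InCone ks i j ls x → InNormalConeOfEdge B₁ B₂ x))

{-# OPTIONS --safe #-}
module Submission where

-- All conditions are compared with (2): r(iK) = r(jK) = r(ijK) = r(K) + 1.
-- (1) ⇔ (2) is submodularity on iK ∪ jK = ijK, iK ∩ jK = K plus the unit increase of r.
-- (3)–(6) are read off a basis B of M|K: iB is independent exactly when r jumps at i, and a
-- circuit in ijK through only one of i, j would put that element in the closure of K.
-- For (7), the greedy bases G₁ of ks,i,j,ls and G₂ of ks,j,i,ls maximise every functional
-- in the cone (Abel summation), so the cone lies in the normal cone of [G₁, G₂].  Under (2)
-- they differ exactly in i and j, and a functional strictly decreasing along ks,i,ls with
-- x_i = x_j is maximised only at them, so [G₁, G₂] is an edge.  Conversely the indicators of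
-- the prefix sets of ks,i,j,ls that do not separate i from j lie in the cone, so both ends of
-- an edge are tight on them; this fixes everything outside {i, j}, and when
-- r(iK) + r(jK) = r(ijK) + r(K) it fixes i and j as well, so the ends would coincide.

open import Defs
open import Algebra.Bundles using (CommutativeMonoid)
import Algebra.Properties.CommutativeSemigroup as CommSemigroupProps
import Algebra.Properties.Monoid.Mult as MonoidMult
import Algebra.Solver.IdempotentCommutativeMonoid as ICM-Solver
open import Data.Bool using (Bool; true; false; if_then_else_; _∨_; _∧_)
open import Data.Bool.Properties using (∧-zeroʳ)
open import Data.Empty using (⊥-elim)
open import Data.Fin as Fin using (Fin; zero; suc)
import Data.Fin.Properties as Finₚ
open import Data.Fin.Subset
open import Data.Fin.Subset.Properties
open import Data.List as List using (List; []; _∷_; _++_; foldr; filter; allFin)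
import Data.List.Properties as Listₚ
open import Data.Nat.ListAction using (sum)
open import Data.List.Membership.Propositional using () renaming (_∈_ to _∈ₗ_)
open import Data.List.Membership.Propositional.Properties
  using (∈-filter⁺; ∈-filter⁻; ∈-allFin; ∈-++⁺ˡ; ∈-++⁺ʳ; ∈-++⁻; ∈-∃++)
open import Data.List.Relation.Unary.All as All using (All; []; _∷_)
import Data.List.Relation.Unary.All.Properties as Allₚ
open import Data.List.Relation.Unary.Linked as Linked using (Linked; []; [-]; _∷_)
import Data.List.Relation.Unary.Linked.Properties as Linkedₚ
open import Data.List.Relation.Unary.Unique.Propositional.Properties using (filter⁺; allFin⁺; ++⁺)
open import Data.List.Relation.Unary.Any using (here; there)
open import Data.List.Relation.Unary.Unique.Propositional using (Unique)
open import Data.List.Relation.Unary.AllPairs using ([]; _∷_)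
open import Data.Nat as ℕ using (ℕ; zero; suc; _+_; _≤_; _<_; z≤n; s≤s)
import Data.Nat.Properties as ℕₚ
open import Data.Nat.Solver using (module +-*-Solver)
open import Data.Product using (_×_; _,_; proj₁; proj₂; ∃; ∃-syntax)
open import Data.Sum using (_⊎_; inj₁; inj₂; [_,_]′)
open import Data.Rational as ℚ using (ℚ; 0ℚ; 1ℚ)
import Data.Rational.Properties as ℚₚ
open import Data.Vec using ([]; _∷_; here; there; lookup)
open import Data.Vec.Properties using ([]=⇒lookup; lookup⇒[]=)
open import Function using (_∘_; flip; _⇔_; mk⇔)
import Function.Properties.Equivalence as Equivalence
open import Relation.Nullary using (¬_; yes; no; Dec)
open import Relation.Nullary.Decidable using (_×-dec_; ¬?; decidable-stable)
open import Relation.Binary.PropositionalEquality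
  using (_≡_; _≢_; refl; sym; trans; cong; cong₂; subst; subst₂; module ≡-Reasoning)

private
  variable
    n : ℕ
    p q : Subset n
    x : Fin n

m≤n≤1+m⇒n≡m⊎n≡1+m : ∀ {m n} → m ≤ n → n ≤ suc m → n ≡ m ⊎ n ≡ suc m
m≤n≤1+m⇒n≡m⊎n≡1+m m≤n n≤1+m with ℕₚ.m≤n⇒m<n∨m≡n n≤1+m
... | inj₁ n<1+m = inj₁ (ℕₚ.≤-antisym (ℕₚ.m<1+n⇒m≤n n<1+m) m≤n)
... | inj₂ n≡1+m = inj₂ n≡1+m

c+k<a+b⇒a≡b≡c≡1+k : ∀ {k a b c} → a ≤ suc k → b ≤ suc k → a ≤ c → b ≤ c → c + k < a + b →
  a ≡ suc k × b ≡ suc k × c ≡ suc k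
c+k<a+b⇒a≡b≡c≡1+k {k} {a} {b} {c} a≤1+k b≤1+k a≤c b≤c gap = a≡1+k , b≡1+k , c≡1+k
  where
  open ℕₚ.≤-Reasoning
  a≡1+k : a ≡ suc k
  a≡1+k = ℕₚ.≤-antisym a≤1+k (ℕₚ.+-cancelˡ-< b k a (begin-strict
    b + k  ≤⟨ ℕₚ.+-monoˡ-≤ k b≤c ⟩
    c + k  <⟨ gap ⟩
    a + b  ≡⟨ ℕₚ.+-comm a b ⟩
    b + a  ∎))
  b≡1+k : b ≡ suc k
  b≡1+k = ℕₚ.≤-antisym b≤1+k (ℕₚ.+-cancelˡ-< a k b (begin-strict
    a + k  ≤⟨ ℕₚ.+-monoˡ-≤ k a≤c ⟩
    c + k  <⟨ gap ⟩
    a + b  ∎))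
  c≡1+k : c ≡ suc k
  c≡1+k = ℕₚ.≤-antisym (ℕₚ.+-cancelʳ-≤ k c (suc k) (ℕₚ.m<1+n⇒m≤n (begin-strict
    c + k          <⟨ gap ⟩
    a + b          ≡⟨ cong₂ _+_ a≡1+k b≡1+k ⟩
    suc k + suc k  ≡⟨ cong suc (ℕₚ.+-suc k k) ⟩
    suc (suc k + k) ∎))) (subst (_≤ c) a≡1+k a≤c)

m≤o⇒n≤p⇒m+n≡o+p⇒m≡o : ∀ {m n o p} → m ≤ o → n ≤ p → m + n ≡ o + p → m ≡ o
m≤o⇒n≤p⇒m+n≡o+p⇒m≡o m≤o n≤p m+n≡o+p with ℕₚ.m≤n⇒m<n∨m≡n m≤o
... | inj₁ m<o = ⊥-elim (ℕₚ.<-irrefl m+n≡o+p (ℕₚ.+-mono-<-≤ m<o n≤p))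
... | inj₂ m≡o = m≡o

open MonoidMult ℚₚ.+-0-monoid using (×-homo-1; ×-homo-+) renaming (_×_ to _·_)

0≤1 : 0ℚ ℚ.≤ 1ℚ
0≤1 = ℚₚ.nonNegative⁻¹ 1ℚ

+-cancelˡ-≤ : ∀ r {p q} → r ℚ.+ p ℚ.≤ r ℚ.+ q → p ℚ.≤ q
+-cancelˡ-≤ r {p} {q} r+p≤r+q = subst₂ ℚ._≤_ (cancel p) (cancel q) (ℚₚ.+-monoʳ-≤ (ℚ.- r) r+p≤r+q)
  where
  cancel : ∀ s → ℚ.- r ℚ.+ (r ℚ.+ s) ≡ s
  cancel s = trans (sym (ℚₚ.+-assoc (ℚ.- r) r s)) (trans (cong (ℚ._+ s) (ℚₚ.+-inverseˡ r)) (ℚₚ.+-identityˡ s))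

·-monoʳ-≤ : ∀ k {p q} → p ℚ.≤ q → k · p ℚ.≤ k · q
·-monoʳ-≤ zero    p≤q = ℚₚ.≤-refl
·-monoʳ-≤ (suc k) p≤q = ℚₚ.+-mono-≤ p≤q (·-monoʳ-≤ k p≤q)

0≤·1 : ∀ k → 0ℚ ℚ.≤ k · 1ℚ
0≤·1 zero    = ℚₚ.≤-refl
0≤·1 (suc k) = ℚₚ.+-mono-≤ 0≤1 (0≤·1 k)

·1-cancel-≤ : ∀ m n → m · 1ℚ ℚ.≤ n · 1ℚ → m ≤ n
·1-cancel-≤ zero    n       _       = z≤n
·1-cancel-≤ (suc m) zero    1+m≤0   =
  ⊥-elim (ℚₚ.<-irrefl refl (ℚₚ.<-≤-trans (ℚₚ.positive⁻¹ 1ℚ) (ℚₚ.≤-trans 1≤1+m 1+m≤0)))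
  where
  1≤1+m : 1ℚ ℚ.≤ 1ℚ ℚ.+ m · 1ℚ
  1≤1+m = subst (ℚ._≤ 1ℚ ℚ.+ m · 1ℚ) (ℚₚ.+-identityʳ 1ℚ) (ℚₚ.+-monoʳ-≤ 1ℚ (0≤·1 m))
·1-cancel-≤ (suc m) (suc n) 1+m≤1+n = s≤s (·1-cancel-≤ m n (+-cancelˡ-≤ 1ℚ 1+m≤1+n))

·1-mono-≤ : ∀ {m n} → m ≤ n → m · 1ℚ ℚ.≤ n · 1ℚ
·1-mono-≤ {n = n} z≤n = 0≤·1 n
·1-mono-≤ (s≤s m≤n) = ℚₚ.+-monoʳ-≤ 1ℚ (·1-mono-≤ m≤n)

module ∪-Solver {n : ℕ} = ICM-Solver (∪-idempotentCommutativeMonoid n)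
module ∩-Solver {n : ℕ} = ICM-Solver (∩-idempotentCommutativeMonoid n)

∣p∪q∣+∣p∩q∣≡∣p∣+∣q∣ : ∀ (p q : Subset n) → ∣ p ∪ q ∣ + ∣ p ∩ q ∣ ≡ ∣ p ∣ + ∣ q ∣
∣p∪q∣+∣p∩q∣≡∣p∣+∣q∣ []          []          = refl
∣p∪q∣+∣p∩q∣≡∣p∣+∣q∣ (true  ∷ p) (true  ∷ q) =
  cong suc (trans (ℕₚ.+-suc _ _) (trans (cong suc (∣p∪q∣+∣p∩q∣≡∣p∣+∣q∣ p q)) (sym (ℕₚ.+-suc _ _))))
∣p∪q∣+∣p∩q∣≡∣p∣+∣q∣ (true  ∷ p) (false ∷ q) = cong suc (∣p∪q∣+∣p∩q∣≡∣p∣+∣q∣ p q)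
∣p∪q∣+∣p∩q∣≡∣p∣+∣q∣ (false ∷ p) (true  ∷ q) = trans (cong suc (∣p∪q∣+∣p∩q∣≡∣p∣+∣q∣ p q)) (sym (ℕₚ.+-suc _ _))
∣p∪q∣+∣p∩q∣≡∣p∣+∣q∣ (false ∷ p) (false ∷ q) = ∣p∪q∣+∣p∩q∣≡∣p∣+∣q∣ p q

∣p∣≡∣p∩q∣+∣p∩∁q∣ : ∀ (p q : Subset n) → ∣ p ∣ ≡ ∣ p ∩ q ∣ + ∣ p ∩ ∁ q ∣
∣p∣≡∣p∩q∣+∣p∩∁q∣ []          []          = refl
∣p∣≡∣p∩q∣+∣p∩∁q∣ (true  ∷ p) (true  ∷ q) = cong suc (∣p∣≡∣p∩q∣+∣p∩∁q∣ p q)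
∣p∣≡∣p∩q∣+∣p∩∁q∣ (true  ∷ p) (false ∷ q) = trans (cong suc (∣p∣≡∣p∩q∣+∣p∩∁q∣ p q)) (sym (ℕₚ.+-suc _ _))
∣p∣≡∣p∩q∣+∣p∩∁q∣ (false ∷ p) (_     ∷ q) = ∣p∣≡∣p∩q∣+∣p∩∁q∣ p q

p∩q≡⊥⇒∣p∪q∣≡∣p∣+∣q∣ : ∀ (p q : Subset n) → p ∩ q ≡ ⊥ → ∣ p ∪ q ∣ ≡ ∣ p ∣ + ∣ q ∣
p∩q≡⊥⇒∣p∪q∣≡∣p∣+∣q∣ {n} p q p∩q≡⊥ = begin
  ∣ p ∪ q ∣               ≡⟨ ℕₚ.+-identityʳ _ ⟨
  ∣ p ∪ q ∣ + 0           ≡⟨ cong (∣ p ∪ q ∣ +_) (trans (cong ∣_∣ p∩q≡⊥) (∣⊥∣≡0 n)) ⟨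
  ∣ p ∪ q ∣ + ∣ p ∩ q ∣   ≡⟨ ∣p∪q∣+∣p∩q∣≡∣p∣+∣q∣ p q ⟩
  ∣ p ∣ + ∣ q ∣           ∎
  where open ≡-Reasoning

x∈p⇒p∩⁅x⁆≡⁅x⁆ : x ∈ p → p ∩ ⁅ x ⁆ ≡ ⁅ x ⁆
x∈p⇒p∩⁅x⁆≡⁅x⁆ {p = true ∷ p} here      = cong (true ∷_) (∩-zeroʳ p)
x∈p⇒p∩⁅x⁆≡⁅x⁆ {p = s ∷ p}    (there h) = cong₂ _∷_ (∧-zeroʳ s) (x∈p⇒p∩⁅x⁆≡⁅x⁆ h)

x∉p⇒p∩⁅x⁆≡⊥ : x ∉ p → p ∩ ⁅ x ⁆ ≡ ⊥
x∉p⇒p∩⁅x⁆≡⊥ {x = zero}  {p = true  ∷ p} x∉p = ⊥-elim (x∉p here)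
x∉p⇒p∩⁅x⁆≡⊥ {x = zero}  {p = false ∷ p} x∉p = cong (false ∷_) (∩-zeroʳ p)
x∉p⇒p∩⁅x⁆≡⊥ {x = suc x} {p = s ∷ p}     x∉p = cong₂ _∷_ (∧-zeroʳ s) (x∉p⇒p∩⁅x⁆≡⊥ (x∉p ∘ there))

x∈p⇒∣p∩⁅x⁆∣≡1 : x ∈ p → ∣ p ∩ ⁅ x ⁆ ∣ ≡ 1
x∈p⇒∣p∩⁅x⁆∣≡1 {x = x} x∈p = trans (cong ∣_∣ (x∈p⇒p∩⁅x⁆≡⁅x⁆ x∈p)) (∣⁅x⁆∣≡1 x)

x∉p⇒∣p∩⁅x⁆∣≡0 : x ∉ p → ∣ p ∩ ⁅ x ⁆ ∣ ≡ 0
x∉p⇒∣p∩⁅x⁆∣≡0 {n} x∉p = trans (cong ∣_∣ (x∉p⇒p∩⁅x⁆≡⊥ x∉p)) (∣⊥∣≡0 n)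

x∉p⇒∣p∪⁅x⁆∣≡1+∣p∣ : x ∉ p → ∣ p ∪ ⁅ x ⁆ ∣ ≡ suc ∣ p ∣
x∉p⇒∣p∪⁅x⁆∣≡1+∣p∣ {x = x} {p = p} x∉p = begin
  ∣ p ∪ ⁅ x ⁆ ∣      ≡⟨ p∩q≡⊥⇒∣p∪q∣≡∣p∣+∣q∣ p ⁅ x ⁆ (x∉p⇒p∩⁅x⁆≡⊥ x∉p) ⟩
  ∣ p ∣ + ∣ ⁅ x ⁆ ∣  ≡⟨ cong (∣ p ∣ +_) (∣⁅x⁆∣≡1 x) ⟩
  ∣ p ∣ + 1          ≡⟨ ℕₚ.+-comm ∣ p ∣ 1 ⟩
  suc ∣ p ∣          ∎
  where open ≡-Reasoning

p⊆r⇒x∈r⇒p∪⁅x⁆⊆r : ∀ {r : Subset n} → p ⊆ r → x ∈ r → p ∪ ⁅ x ⁆ ⊆ r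
p⊆r⇒x∈r⇒p∪⁅x⁆⊆r {p = p} {x = x} p⊆r x∈r y∈ with x∈p∪q⁻ p ⁅ x ⁆ y∈
... | inj₁ y∈p   = p⊆r y∈p
... | inj₂ y∈⁅x⁆ = subst (_∈ _) (sym (x∈⁅y⁆⇒x≡y x y∈⁅x⁆)) x∈r

x∈p⇒p∪⁅x⁆≡p : x ∈ p → p ∪ ⁅ x ⁆ ≡ p
x∈p⇒p∪⁅x⁆≡p {x = x} x∈p = ⊆-antisym (p⊆r⇒x∈r⇒p∪⁅x⁆⊆r (λ y∈p → y∈p) x∈p) (p⊆p∪q ⁅ x ⁆)

x∈p─q⇒x∉q : x ∈ p ─ q → x ∉ q
x∈p─q⇒x∉q {p = _ ∷ _} {q = _ ∷ _} (there x∈p─q) (there x∈q) = x∈p─q⇒x∉q x∈p─q x∈q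

∪-monoˡ-⊆ : ∀ (r : Subset n) → p ⊆ q → p ∪ r ⊆ q ∪ r
∪-monoˡ-⊆ {p = p} {q = q} r p⊆q y∈ with x∈p∪q⁻ p r y∈
... | inj₁ y∈p = p⊆p∪q r (p⊆q y∈p)
... | inj₂ y∈r = q⊆p∪q q r y∈r

∪-monoʳ-⊆ : ∀ (r : Subset n) → p ⊆ q → r ∪ p ⊆ r ∪ q
∪-monoʳ-⊆ {p = p} {q = q} r p⊆q y∈ with x∈p∪q⁻ r p y∈
... | inj₁ y∈r = p⊆p∪q q y∈r
... | inj₂ y∈p = q⊆p∪q r q (p⊆q y∈p)

x∉p-x : ∀ (p : Subset n) x → x ∉ p - x
x∉p-x p x x∈ = x∈p─q⇒x∉q x∈ (x∈⁅x⁆ x)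

x∈p⇒p-x∪⁅x⁆≡p : x ∈ p → (p - x) ∪ ⁅ x ⁆ ≡ p
x∈p⇒p-x∪⁅x⁆≡p {x = x} {p = p} x∈p = ⊆-antisym (p⊆r⇒x∈r⇒p∪⁅x⁆⊆r (p─q⊆p p ⁅ x ⁆) x∈p) split
  where
  split : p ⊆ (p - x) ∪ ⁅ x ⁆
  split {y} y∈p with y Fin.≟ x
  ... | yes refl = q⊆p∪q (p - y) ⁅ y ⁆ (x∈⁅x⁆ y)
  ... | no  y≢x  = p⊆p∪q ⁅ x ⁆ (x∈p∧x≢y⇒x∈p-y y∈p y≢x)

x∉q⇒∣p∩q∪⁅x⁆∣≡∣p∩q∣+∣p∩⁅x⁆∣ : ∀ (p : Subset n) {q} → x ∉ q → ∣ p ∩ (q ∪ ⁅ x ⁆) ∣ ≡ ∣ p ∩ q ∣ + ∣ p ∩ ⁅ x ⁆ ∣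
x∉q⇒∣p∩q∪⁅x⁆∣≡∣p∩q∣+∣p∩⁅x⁆∣ {x = x} p {q} x∉q =
  trans (cong ∣_∣ (∩-distribˡ-∪ p q ⁅ x ⁆)) (p∩q≡⊥⇒∣p∪q∣≡∣p∣+∣q∣ (p ∩ q) (p ∩ ⁅ x ⁆) (begin
    (p ∩ q) ∩ (p ∩ ⁅ x ⁆)  ≡⟨ solve 3 (λ p q x → (p ⊕ q) ⊕ (p ⊕ x) ⊜ p ⊕ (q ⊕ x)) refl p q ⁅ x ⁆ ⟩
    p ∩ (q ∩ ⁅ x ⁆)        ≡⟨ cong (p ∩_) (x∉p⇒p∩⁅x⁆≡⊥ x∉q) ⟩
    p ∩ ⊥                  ≡⟨ ∩-zeroʳ p ⟩
    ⊥                      ∎))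
  where
  open ≡-Reasoning
  open ∩-Solver

∣p∩⁅x⁆∣≡1⇒x∈p : ∣ p ∩ ⁅ x ⁆ ∣ ≡ 1 → x ∈ p
∣p∩⁅x⁆∣≡1⇒x∈p {p = p} {x = x} one with x ∈? p
... | yes x∈p = x∈p
... | no  x∉p = ⊥-elim (ℕₚ.1+n≢0 (trans (sym one) (x∉p⇒∣p∩⁅x⁆∣≡0 x∉p)))

∣p∩⁅x⁆∣≡0⇒x∉p : ∣ p ∩ ⁅ x ⁆ ∣ ≡ 0 → x ∉ p
∣p∩⁅x⁆∣≡0⇒x∉p none x∈p = ℕₚ.1+n≢0 (trans (sym (x∈p⇒∣p∩⁅x⁆∣≡1 x∈p)) none)

∣p∩⁅x⁆∣≡∣q∩⁅x⁆∣⇒x∈p⇒x∈q : ∣ p ∩ ⁅ x ⁆ ∣ ≡ ∣ q ∩ ⁅ x ⁆ ∣ → x ∈ p → x ∈ q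
∣p∩⁅x⁆∣≡∣q∩⁅x⁆∣⇒x∈p⇒x∈q same x∈p = ∣p∩⁅x⁆∣≡1⇒x∈p (trans (sym same) (x∈p⇒∣p∩⁅x⁆∣≡1 x∈p))

agree-on-new-element : ∀ {T : Subset n} → x ∉ T → ∣ p ∩ T ∣ ≡ ∣ q ∩ T ∣ →
  ∣ p ∩ (T ∪ ⁅ x ⁆) ∣ ≡ ∣ q ∩ (T ∪ ⁅ x ⁆) ∣ → x ∈ p → x ∈ q
agree-on-new-element {p = p} {q = q} {T = T} x∉T same-T same-T+x =
  ∣p∩⁅x⁆∣≡∣q∩⁅x⁆∣⇒x∈p⇒x∈q (ℕₚ.+-cancelˡ-≡ ∣ p ∩ T ∣ _ _ (begin
    ∣ p ∩ T ∣ + ∣ p ∩ ⁅ _ ⁆ ∣  ≡⟨ x∉q⇒∣p∩q∪⁅x⁆∣≡∣p∩q∣+∣p∩⁅x⁆∣ p x∉T ⟨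
    ∣ p ∩ (T ∪ ⁅ _ ⁆) ∣        ≡⟨ same-T+x ⟩
    ∣ q ∩ (T ∪ ⁅ _ ⁆) ∣        ≡⟨ x∉q⇒∣p∩q∪⁅x⁆∣≡∣p∩q∣+∣p∩⁅x⁆∣ q x∉T ⟩
    ∣ q ∩ T ∣ + ∣ q ∩ ⁅ _ ⁆ ∣  ≡⟨ cong (_+ ∣ q ∩ ⁅ _ ⁆ ∣) same-T ⟨
    ∣ p ∩ T ∣ + ∣ q ∩ ⁅ _ ⁆ ∣  ∎))
  where open ≡-Reasoning

fromList : List (Fin n) → Subset n
fromList []      = ⊥
fromList (a ∷ L) = ⁅ a ⁆ ∪ fromList L

∈-fromList⁺ : ∀ {L : List (Fin n)} → x ∈ₗ L → x ∈ fromList L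
∈-fromList⁺ {L = a ∷ L} (here refl) = p⊆p∪q (fromList L) (x∈⁅x⁆ a)
∈-fromList⁺ {L = a ∷ L} (there x∈L) = q⊆p∪q ⁅ a ⁆ (fromList L) (∈-fromList⁺ x∈L)

∈-fromList⁻ : ∀ {L : List (Fin n)} → x ∈ fromList L → x ∈ₗ L
∈-fromList⁻ {L = []}    x∈⊥ = ⊥-elim (∉⊥ x∈⊥)
∈-fromList⁻ {L = a ∷ L} x∈  with x∈p∪q⁻ ⁅ a ⁆ (fromList L) x∈
... | inj₁ x∈⁅a⁆ = here (x∈⁅y⁆⇒x≡y a x∈⁅a⁆)
... | inj₂ x∈L   = there (∈-fromList⁻ x∈L)

fromList-++ : ∀ (L L′ : List (Fin n)) → fromList (L ++ L′) ≡ fromList L ∪ fromList L′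
fromList-++ []      L′ = sym (∪-identityˡ _)
fromList-++ (a ∷ L) L′ = trans (cong (⁅ a ⁆ ∪_) (fromList-++ L L′)) (sym (∪-assoc ⁅ a ⁆ _ _))

fromList-∷ʳ : ∀ (L : List (Fin n)) a → fromList (L ++ a ∷ []) ≡ fromList L ∪ ⁅ a ⁆
fromList-∷ʳ L a = trans (fromList-++ L (a ∷ [])) (cong (fromList L ∪_) (∪-identityʳ ⁅ a ⁆))

fromList-covering : (L : List (Fin n)) → (∀ e → e ∈ₗ L) → fromList L ≡ ⊤
fromList-covering L covers = ⊆-antisym ⊆⊤ (λ {e} _ → ∈-fromList⁺ (covers e))

toList : Subset n → List (Fin n)
toList {n} S = filter (_∈? S) (allFin n)

fromList-toList : ∀ (S : Subset n) → fromList (toList S) ≡ S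
fromList-toList {n} S = ⊆-antisym
  (λ e∈ → proj₂ (∈-filter⁻ (_∈? S) {xs = allFin n} (∈-fromList⁻ e∈)))
  (λ {e} e∈S → ∈-fromList⁺ (∈-filter⁺ (_∈? S) (∈-allFin e) e∈S))

toList-orders : ∀ (M : Matroid n) S → OrderingOf M S (toList S)
toList-orders {n} M S =
  filter⁺ (_∈? S) (allFin⁺ n) ,
  (λ e e∈S → ∈-filter⁺ (_∈? S) (∈-allFin e) e∈S) ,
  (λ e e∈ → proj₂ (∈-filter⁻ (_∈? S) {xs = allFin n} e∈))

head∉fromList : ∀ {a} {L : List (Fin n)} → Unique (a ∷ L) → a ∉ fromList L
head∉fromList (a≢L ∷ _) a∈L = All.lookup a≢L (∈-fromList⁻ a∈L) refl

module _ {A : Set} (_∙_ : A → A → A) (ε : A) (f : Subset n → A)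
         (f-⊥ : f ⊥ ≡ ε) (f-∪ : ∀ p q → p ∩ q ≡ ⊥ → f (p ∪ q) ≡ f p ∙ f q) where

  additive-∩fromList : ∀ B (L : List (Fin n)) → Unique L →
    f (B ∩ fromList L) ≡ foldr _∙_ ε (List.map (λ a → f (B ∩ ⁅ a ⁆)) L)
  additive-∩fromList B []      _            = trans (cong f (∩-zeroʳ B)) f-⊥
  additive-∩fromList B (a ∷ L) u@(_ ∷ uL) = begin
    f (B ∩ (⁅ a ⁆ ∪ fromList L))              ≡⟨ cong f (∩-distribˡ-∪ B ⁅ a ⁆ (fromList L)) ⟩
    f ((B ∩ ⁅ a ⁆) ∪ (B ∩ fromList L))        ≡⟨ f-∪ _ _ disjoint ⟩
    f (B ∩ ⁅ a ⁆) ∙ f (B ∩ fromList L)        ≡⟨ cong (f (B ∩ ⁅ a ⁆) ∙_) (additive-∩fromList B L uL) ⟩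
    f (B ∩ ⁅ a ⁆) ∙ foldr _∙_ ε (List.map (λ a → f (B ∩ ⁅ a ⁆)) L) ∎
    where
    open ≡-Reasoning
    disjoint : (B ∩ ⁅ a ⁆) ∩ (B ∩ fromList L) ≡ ⊥
    disjoint = begin
      (B ∩ ⁅ a ⁆) ∩ (B ∩ fromList L)  ≡⟨ ∩-assoc B _ _ ⟩
      B ∩ (⁅ a ⁆ ∩ (B ∩ fromList L))  ≡⟨ cong (B ∩_) (∩-comm ⁅ a ⁆ _) ⟩
      B ∩ ((B ∩ fromList L) ∩ ⁅ a ⁆)  ≡⟨ cong (B ∩_) (x∉p⇒p∩⁅x⁆≡⊥ (head∉fromList u ∘ p∩q⊆q B _)) ⟩
      B ∩ ⊥                           ≡⟨ ∩-zeroʳ B ⟩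
      ⊥                               ∎

∣∩fromList∣ : ∀ (B : Subset n) L → Unique L → ∣ B ∩ fromList L ∣ ≡ sum (List.map (λ a → ∣ B ∩ ⁅ a ⁆ ∣) L)
∣∩fromList∣ {n} = additive-∩fromList _+_ 0 ∣_∣ (∣⊥∣≡0 n) p∩q≡⊥⇒∣p∪q∣≡∣p∣+∣q∣

open CommSemigroupProps (CommutativeMonoid.commutativeSemigroup ℚₚ.+-0-commutativeMonoid) using (interchange)
weight-⊥ : ∀ (x : Fin n → ℚ) → weight x ⊥ ≡ 0ℚ
weight-⊥ {zero}  x = refl
weight-⊥ {suc n} x = trans (ℚₚ.+-identityˡ _) (weight-⊥ (x ∘ suc))

weight-⁅⁆ : ∀ (x : Fin n → ℚ) e → weight x ⁅ e ⁆ ≡ x e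
weight-⁅⁆ x zero    = trans (cong (x zero ℚ.+_) (weight-⊥ (x ∘ suc))) (ℚₚ.+-identityʳ _)
weight-⁅⁆ x (suc e) = trans (ℚₚ.+-identityˡ _) (weight-⁅⁆ (x ∘ suc) e)

weight-∪∩ : ∀ (x : Fin n → ℚ) p q → weight x (p ∪ q) ℚ.+ weight x (p ∩ q) ≡ weight x p ℚ.+ weight x q
weight-∪∩ x []      []      = refl
weight-∪∩ x (s ∷ p) (t ∷ q) = begin
  (h (s ∨ t) ℚ.+ weight x′ (p ∪ q)) ℚ.+ (h (s ∧ t) ℚ.+ weight x′ (p ∩ q)) ≡⟨ interchange (h (s ∨ t)) _ (h (s ∧ t)) _ ⟩
  (h (s ∨ t) ℚ.+ h (s ∧ t)) ℚ.+ (weight x′ (p ∪ q) ℚ.+ weight x′ (p ∩ q)) ≡⟨ cong₂ ℚ._+_ (heads s t) (weight-∪∩ x′ p q) ⟩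
  (h s ℚ.+ h t) ℚ.+ (weight x′ p ℚ.+ weight x′ q)                          ≡⟨ interchange (h s) (h t) _ _ ⟩
  (h s ℚ.+ weight x′ p) ℚ.+ (h t ℚ.+ weight x′ q)                          ∎
  where
  open ≡-Reasoning
  x′ : Fin _ → ℚ
  x′ = x ∘ suc
  h : Bool → ℚ
  h b = if b then x zero else 0ℚ
  heads : ∀ s t → h (s ∨ t) ℚ.+ h (s ∧ t) ≡ h s ℚ.+ h t
  heads true  true  = refl
  heads true  false = refl
  heads false true  = ℚₚ.+-comm (x zero) 0ℚ
  heads false false = refl

weight-disjoint-∪ : ∀ (x : Fin n → ℚ) p q → p ∩ q ≡ ⊥ → weight x (p ∪ q) ≡ weight x p ℚ.+ weight x q
weight-disjoint-∪ x p q p∩q≡⊥ = begin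
  weight x (p ∪ q)                          ≡⟨ ℚₚ.+-identityʳ _ ⟨
  weight x (p ∪ q) ℚ.+ 0ℚ                   ≡⟨ cong (weight x (p ∪ q) ℚ.+_) (trans (cong (weight x) p∩q≡⊥) (weight-⊥ x)) ⟨
  weight x (p ∪ q) ℚ.+ weight x (p ∩ q)     ≡⟨ weight-∪∩ x p q ⟩
  weight x p ℚ.+ weight x q                 ∎
  where open ≡-Reasoning

weight-∩⁅⁆ : ∀ (x : Fin n → ℚ) B e → weight x (B ∩ ⁅ e ⁆) ≡ ∣ B ∩ ⁅ e ⁆ ∣ · x e
weight-∩⁅⁆ x B e with e ∈? B
... | yes e∈B = begin
  weight x (B ∩ ⁅ e ⁆)      ≡⟨ cong (weight x) (x∈p⇒p∩⁅x⁆≡⁅x⁆ e∈B) ⟩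
  weight x ⁅ e ⁆            ≡⟨ weight-⁅⁆ x e ⟩
  x e                       ≡⟨ ×-homo-1 (x e) ⟨
  1 · x e                   ≡⟨ cong (_· x e) (x∈p⇒∣p∩⁅x⁆∣≡1 e∈B) ⟨
  ∣ B ∩ ⁅ e ⁆ ∣ · x e       ∎
  where open ≡-Reasoning
... | no e∉B = begin
  weight x (B ∩ ⁅ e ⁆)      ≡⟨ cong (weight x) (x∉p⇒p∩⁅x⁆≡⊥ e∉B) ⟩
  weight x ⊥                ≡⟨ weight-⊥ x ⟩
  0 · x e                   ≡⟨ cong (_· x e) (x∉p⇒∣p∩⁅x⁆∣≡0 e∉B) ⟨
  ∣ B ∩ ⁅ e ⁆ ∣ · x e       ∎
  where open ≡-Reasoning

weight-∩fromList : ∀ (x : Fin n → ℚ) B L → Unique L →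
  weight x (B ∩ fromList L) ≡ foldr ℚ._+_ 0ℚ (List.map (λ a → ∣ B ∩ ⁅ a ⁆ ∣ · x a) L)
weight-∩fromList x B L u =
  trans (additive-∩fromList ℚ._+_ 0ℚ (weight x) (weight-⊥ x) (weight-disjoint-∪ x) B L u)
        (cong (foldr ℚ._+_ 0ℚ) (Listₚ.map-cong (weight-∩⁅⁆ x B) L))

weight-+ : ∀ (x z : Fin n → ℚ) B → weight (λ e → x e ℚ.+ z e) B ≡ weight x B ℚ.+ weight z B
weight-+ x z []      = sym (ℚₚ.+-identityˡ 0ℚ)
weight-+ x z (b ∷ B) = begin
  h (λ e → x e ℚ.+ z e) b ℚ.+ weight (λ e → x (suc e) ℚ.+ z (suc e)) B
    ≡⟨ cong₂ ℚ._+_ (heads b) (weight-+ (x ∘ suc) (z ∘ suc) B) ⟩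
  (h x b ℚ.+ h z b) ℚ.+ (weight (x ∘ suc) B ℚ.+ weight (z ∘ suc) B)
    ≡⟨ interchange (h x b) (h z b) _ _ ⟩
  (h x b ℚ.+ weight (x ∘ suc) B) ℚ.+ (h z b ℚ.+ weight (z ∘ suc) B)
    ∎
  where
  open ≡-Reasoning
  h : (Fin _ → ℚ) → Bool → ℚ
  h y b = if b then y zero else 0ℚ
  heads : ∀ b → h (λ e → x e ℚ.+ z e) b ≡ h x b ℚ.+ h z b
  heads true  = refl
  heads false = sym (ℚₚ.+-identityˡ 0ℚ)

indicator : Subset n → Fin n → ℚ
indicator T e = if lookup T e then 1ℚ else 0ℚ

indicator-∈ : ∀ {T : Subset n} {e} → e ∈ T → indicator T e ≡ 1ℚ
indicator-∈ e∈T = cong (if_then 1ℚ else 0ℚ) ([]=⇒lookup e∈T)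

indicator-∉ : ∀ {T : Subset n} {e} → e ∉ T → indicator T e ≡ 0ℚ
indicator-∉ {T = T} {e} e∉T with lookup T e in eq
... | true  = ⊥-elim (e∉T (lookup⇒[]= e T eq))
... | false = refl

0≤indicator : ∀ (T : Subset n) e → 0ℚ ℚ.≤ indicator T e
0≤indicator T e with lookup T e
... | true  = 0≤1
... | false = ℚₚ.≤-refl

indicator≤1 : ∀ (T : Subset n) e → indicator T e ℚ.≤ 1ℚ
indicator≤1 T e with lookup T e
... | true  = ℚₚ.≤-refl
... | false = 0≤1

weight-indicator : ∀ (T B : Subset n) → weight (indicator T) B ≡ ∣ B ∩ T ∣ · 1ℚ
weight-indicator []          []          = refl
weight-indicator (true  ∷ T) (true  ∷ B) = cong (1ℚ ℚ.+_) (weight-indicator T B)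
weight-indicator (false ∷ T) (true  ∷ B) = trans (ℚₚ.+-identityˡ _) (weight-indicator T B)
weight-indicator (_     ∷ T) (false ∷ B) = trans (ℚₚ.+-identityˡ _) (weight-indicator T B)

-- Descending sequences and Abel summation

Descending : {A : Set} → (A → ℚ) → List A → Set
Descending x = Linked (λ a b → x b ℚ.≤ x a)

module _ {A : Set} {x : A → ℚ} where

  descending-insert : ∀ us {v c ws} → x c ≡ x v → Descending x (us ++ v ∷ ws) → Descending x (us ++ v ∷ c ∷ ws)
  descending-insert []            {ws = []}     xc≡xv [-]     = ℚₚ.≤-reflexive xc≡xv ∷ [-]
  descending-insert []            {ws = w ∷ ws} xc≡xv (r ∷ d) = ℚₚ.≤-reflexive xc≡xv ∷ subst (x w ℚ.≤_) (sym xc≡xv) r ∷ d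
  descending-insert (u ∷ [])      xc≡xv (r ∷ d) = r ∷ descending-insert [] xc≡xv d
  descending-insert (u ∷ u′ ∷ us) xc≡xv (r ∷ d) = r ∷ descending-insert (u′ ∷ us) xc≡xv d

  descending-delete : ∀ us {v c ws} → Descending x (us ++ v ∷ c ∷ ws) → Descending x (us ++ v ∷ ws)
  descending-delete []            (_ ∷ [-])    = [-]
  descending-delete []            (r ∷ r′ ∷ d) = ℚₚ.≤-trans r′ r ∷ d
  descending-delete (u ∷ [])      (r ∷ d)      = r ∷ descending-delete [] d
  descending-delete (u ∷ u′ ∷ us) (r ∷ d)      = r ∷ descending-delete (u′ ∷ us) d

  descending-replace : ∀ us {v c ws} → x c ≡ x v → Descending x (us ++ v ∷ ws) → Descending x (us ++ c ∷ ws)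
  descending-replace us {v} {c} {ws} xc≡xv d =
    Linkedₚ.map⁻ (subst (Linked (flip ℚ._≤_)) same-values (Linkedₚ.map⁺ d))
    where
    same-values : List.map x (us ++ v ∷ ws) ≡ List.map x (us ++ c ∷ ws)
    same-values = trans (Listₚ.map-++ x us (v ∷ ws))
      (trans (cong (λ y → List.map x us ++ y ∷ List.map x ws) (sym xc≡xv)) (sym (Listₚ.map-++ x us (c ∷ ws))))

descending-+ : ∀ {A : Set} {y z : A → ℚ} {L} → Linked (λ a b → y b ℚ.+ 1ℚ ℚ.≤ y a) L →
  (∀ a → 0ℚ ℚ.≤ z a) → (∀ a → z a ℚ.≤ 1ℚ) → Descending (λ a → y a ℚ.+ z a) L
descending-+ {y = y} {z} steep 0≤z z≤1 = Linked.map (λ {a} {b} yb+1≤ya → begin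
  y b ℚ.+ z b    ≤⟨ ℚₚ.+-monoʳ-≤ (y b) (z≤1 b) ⟩
  y b ℚ.+ 1ℚ     ≤⟨ yb+1≤ya ⟩
  y a            ≡⟨ ℚₚ.+-identityʳ (y a) ⟨
  y a ℚ.+ 0ℚ     ≤⟨ ℚₚ.+-monoʳ-≤ (y a) (0≤z a) ⟩
  y a ℚ.+ z a    ∎) steep
  where open ℚₚ.≤-Reasoning

module _ {A : Set} {P Q : A → Set} {R : A → A → Set} where

  linked-++⁺ : (∀ {a b} → P a → R a b) → (∀ {a b} → Q b → R a b) →
    ∀ xs {ys} → All P xs → All Q ys → Linked R (xs ++ ys)
  linked-++⁺ P⇒R Q⇒R []       _ []             = []
  linked-++⁺ P⇒R Q⇒R []       _ (_ ∷ [])       = [-]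
  linked-++⁺ P⇒R Q⇒R []       _ (_ ∷ qy ∷ qys) = Q⇒R qy ∷ linked-++⁺ P⇒R Q⇒R [] [] (qy ∷ qys)
  linked-++⁺ P⇒R Q⇒R (x ∷ xs) (px ∷ pxs) qys   = cons (P⇒R px) (linked-++⁺ P⇒R Q⇒R xs pxs qys)
    where
    cons : ∀ {a zs} → (∀ {b} → R a b) → Linked R zs → Linked R (a ∷ zs)
    cons Ra []       = [-]
    cons Ra [-]      = Ra ∷ [-]
    cons Ra (r ∷ rs) = Ra ∷ r ∷ rs

module _ {A : Set} {P : A → Set} {R S : A → A → Set} where

  linked-map-All : (∀ {a b} → P a → P b → R a b → S a b) → ∀ {xs} → All P xs → Linked R xs → Linked S xs
  linked-map-All R⇒S []                []         = []
  linked-map-All R⇒S (_ ∷ [])          [-]        = [-]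
  linked-map-All R⇒S (pa ∷ pb ∷ ps)    (r ∷ rs)   = R⇒S pa pb r ∷ linked-map-All R⇒S (pb ∷ ps) rs

unique-prefix : ∀ {A : Set} (as : List A) {bs} → Unique (as ++ bs) → Unique as
unique-prefix []       _        = []
unique-prefix (a ∷ as) (a∉ ∷ u) = Allₚ.++⁻ˡ as a∉ ∷ unique-prefix as u

unique⇒∉suffix : ∀ {n} (P : List (Fin n)) {Q e} → Unique (P ++ Q) → e ∈ₗ Q → e ∉ fromList P
unique⇒∉suffix []      _        _   e∈⊥ = ∉⊥ e∈⊥
unique⇒∉suffix (a ∷ P) (a∉ ∷ u) e∈Q e∈  with x∈p∪q⁻ ⁅ a ⁆ (fromList P) e∈
... | inj₁ e∈⁅a⁆ = All.lookup a∉ (∈-++⁺ʳ P e∈Q) (sym (x∈⁅y⁆⇒x≡y a e∈⁅a⁆))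
... | inj₂ e∈P   = unique⇒∉suffix P u e∈Q e∈P

prefix-indicator-descending : ∀ {n} (P : List (Fin n)) {Q} → Unique (P ++ Q) →
  Descending (indicator (fromList P)) (P ++ Q)
prefix-indicator-descending P {Q} unique = linked-++⁺
  (λ {a} {b} a∈P → subst (indicator (fromList P) b ℚ.≤_) (sym (indicator-∈ a∈P)) (indicator≤1 (fromList P) b))
  (λ {a} {b} b∉P → subst (ℚ._≤ indicator (fromList P) a) (sym (indicator-∉ b∉P)) (0≤indicator (fromList P) a))
  P (All.tabulate ∈-fromList⁺) (All.tabulate (unique⇒∉suffix P unique))

height : List (Fin n) → Fin n → ℕ
height []      e = 0
height (a ∷ L) e with e Fin.≟ a
... | yes _ = List.length L
... | no  _ = height L e

height-here : ∀ a (L : List (Fin n)) → height (a ∷ L) a ≡ List.length L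
height-here a L with a Fin.≟ a
... | yes _   = refl
... | no  a≢a = ⊥-elim (a≢a refl)

height-there : ∀ {a e} (L : List (Fin n)) → e ≢ a → height (a ∷ L) e ≡ height L e
height-there {a = a} {e} L e≢a with e Fin.≟ a
... | yes e≡a = ⊥-elim (e≢a e≡a)
... | no  _   = refl

height-descending : ∀ (L : List (Fin n)) → Unique L → Linked (λ a b → suc (height L b) ≤ height L a) L
height-descending []           _                   = []
height-descending (a ∷ [])     _                   = [-]
height-descending (a ∷ b ∷ L) ((a≢b ∷ a≢L) ∷ unique) =
  ℕₚ.≤-reflexive head-step ∷ linked-map-All shift (a≢b ∷ a≢L) (height-descending (b ∷ L) unique)
  where
  open ≡-Reasoning
  head-step : suc (height (a ∷ b ∷ L) b) ≡ height (a ∷ b ∷ L) a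
  head-step = begin
    suc (height (a ∷ b ∷ L) b)  ≡⟨ cong suc (height-there (b ∷ L) (a≢b ∘ sym)) ⟩
    suc (height (b ∷ L) b)      ≡⟨ cong suc (height-here b L) ⟩
    suc (List.length L)         ≡⟨ height-here a (b ∷ L) ⟨
    height (a ∷ b ∷ L) a        ∎
  shift : ∀ {c d} → a ≢ c → a ≢ d → suc (height (b ∷ L) d) ≤ height (b ∷ L) c →
    suc (height (a ∷ b ∷ L) d) ≤ height (a ∷ b ∷ L) c
  shift a≢c a≢d = subst₂ _≤_ (cong suc (sym (height-there (b ∷ L) (a≢d ∘ sym)))) (sym (height-there (b ∷ L) (a≢c ∘ sym)))

weightedSum : {A : Set} → (A → ℚ) → (A → ℕ) → List A → ℚ
weightedSum x β L = foldr ℚ._+_ 0ℚ (List.map (λ a → β a · x a) L)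

module _ {A : Set} (x : A → ℚ) (β γ : A → ℕ) where

  private
    ∑ : (A → ℕ) → List A → ℕ
    ∑ f L = sum (List.map f L)

    bounded-by-head : ∀ {e L} → Descending x (e ∷ L) → All (λ a → x a ℚ.≤ x e) L
    bounded-by-head [-]                   = []
    bounded-by-head (xe′≤xe ∷ descending) = Linkedₚ.Linked⇒All (λ r s → ℚₚ.≤-trans s r) xe′≤xe descending

  -- Invariant: γ is ahead of β by d, accumulated on values at least u.
  abel-shifted : ∀ d u L → All (λ a → x a ℚ.≤ u) L → Descending x L →
    (∀ as bs → L ≡ as ++ bs → ∑ β as ≤ d + ∑ γ as) → ∑ β L ≡ d + ∑ γ L →
    weightedSum x β L ℚ.≤ d · u ℚ.+ weightedSum x γ L
  abel-shifted d u [] _ _ _ total =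
    subst (λ k → 0ℚ ℚ.≤ k · u ℚ.+ 0ℚ) (sym (ℕₚ.m+n≡0⇒m≡0 d (sym total))) ℚₚ.≤-refl
  abel-shifted d u (e ∷ L) (xe≤u ∷ _) descending prefix total = begin
    β e · x e ℚ.+ weightedSum x β L                   ≤⟨ ℚₚ.+-monoʳ-≤ (β e · x e) rest ⟩
    β e · x e ℚ.+ (d′ · x e ℚ.+ weightedSum x γ L)    ≡⟨ ℚₚ.+-assoc (β e · x e) (d′ · x e) _ ⟨
    (β e · x e ℚ.+ d′ · x e) ℚ.+ weightedSum x γ L    ≡⟨ cong (ℚ._+ weightedSum x γ L) (×-homo-+ (x e) (β e) d′) ⟨
    (β e + d′) · x e ℚ.+ weightedSum x γ L            ≡⟨ cong (λ k → k · x e ℚ.+ weightedSum x γ L) surplus ⟩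
    (d + γ e) · x e ℚ.+ weightedSum x γ L             ≡⟨ cong (ℚ._+ weightedSum x γ L) (×-homo-+ (x e) d (γ e)) ⟩
    (d · x e ℚ.+ γ e · x e) ℚ.+ weightedSum x γ L     ≡⟨ ℚₚ.+-assoc (d · x e) (γ e · x e) _ ⟩
    d · x e ℚ.+ (γ e · x e ℚ.+ weightedSum x γ L)     ≤⟨ ℚₚ.+-monoˡ-≤ _ (·-monoʳ-≤ d xe≤u) ⟩
    d · u ℚ.+ (γ e · x e ℚ.+ weightedSum x γ L)       ∎
    where
    open ℚₚ.≤-Reasoning
    βe≤d+γe : β e ≤ d + γ e
    βe≤d+γe = subst₂ _≤_ (ℕₚ.+-identityʳ (β e)) (cong (d +_) (ℕₚ.+-identityʳ (γ e))) (prefix (e ∷ []) L refl)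
    d′ : ℕ
    d′ = proj₁ (ℕₚ.m≤n⇒∃[o]m+o≡n βe≤d+γe)
    surplus : β e + d′ ≡ d + γ e
    surplus = proj₂ (ℕₚ.m≤n⇒∃[o]m+o≡n βe≤d+γe)
    reshuffle : ∀ s → d + (γ e + s) ≡ β e + (d′ + s)
    reshuffle s = trans (sym (ℕₚ.+-assoc d (γ e) s)) (trans (cong (_+ s) (sym surplus)) (ℕₚ.+-assoc (β e) d′ s))
    rest : weightedSum x β L ℚ.≤ d′ · x e ℚ.+ weightedSum x γ L
    rest = abel-shifted d′ (x e) L (bounded-by-head descending) (Linked.tail descending)
      (λ as bs L≡as++bs → ℕₚ.+-cancelˡ-≤ (β e) _ _
        (subst (β e + ∑ β as ≤_) (reshuffle (∑ γ as)) (prefix (e ∷ as) bs (cong (e ∷_) L≡as++bs))))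
      (ℕₚ.+-cancelˡ-≡ (β e) _ _ (trans total (reshuffle (∑ γ L))))

  abel-≤ : ∀ L → Descending x L →
    (∀ as bs → L ≡ as ++ bs → ∑ β as ≤ ∑ γ as) → ∑ β L ≡ ∑ γ L →
    weightedSum x β L ℚ.≤ weightedSum x γ L
  abel-≤ []      _          _      _     = ℚₚ.≤-refl
  abel-≤ (e ∷ L) descending prefix total =
    subst (weightedSum x β (e ∷ L) ℚ.≤_) (ℚₚ.+-identityˡ _)
      (abel-shifted 0 (x e) (e ∷ L) (ℚₚ.≤-refl ∷ bounded-by-head descending) descending prefix total)

module _ {n : ℕ} (M : Matroid n) where
  open Matroid M

  r-⊥ : r ⊥ ≡ 0
  r-⊥ = ℕₚ.n≤0⇒n≡0 (subst (r ⊥ ≤_) (∣⊥∣≡0 n) (r-bound ⊥))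

  r-∪-≤ : ∀ A C → r (A ∪ C) ≤ r A + ∣ C ∣
  r-∪-≤ A C = ℕₚ.≤-trans (ℕₚ.m≤m+n (r (A ∪ C)) (r (A ∩ C)))
                (ℕₚ.≤-trans (r-submod A C) (ℕₚ.+-monoʳ-≤ (r A) (r-bound C)))

  r[A∪⁅e⁆]≤1+r[A] : ∀ A e → r (A ∪ ⁅ e ⁆) ≤ suc (r A)
  r[A∪⁅e⁆]≤1+r[A] A e = subst (r (A ∪ ⁅ e ⁆) ≤_) (trans (cong (r A +_) (∣⁅x⁆∣≡1 e)) (ℕₚ.+-comm (r A) 1)) (r-∪-≤ A ⁅ e ⁆)

  r[A∪⁅e⁆]-cases : ∀ A e → r (A ∪ ⁅ e ⁆) ≡ r A ⊎ r (A ∪ ⁅ e ⁆) ≡ suc (r A)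
  r[A∪⁅e⁆]-cases A e = m≤n≤1+m⇒n≡m⊎n≡1+m (r-mono A _ (p⊆p∪q ⁅ e ⁆)) (r[A∪⁅e⁆]≤1+r[A] A e)

  independent⇒∣I∣≤r : ∀ {I T} → Independent M I → I ⊆ T → ∣ I ∣ ≤ r T
  independent⇒∣I∣≤r {I} {T} I-indep I⊆T = subst (_≤ r T) I-indep (r-mono I T I⊆T)

  independent-⊆ : ∀ {I A} → Independent M I → A ⊆ I → Independent M A
  independent-⊆ {I} {A} I-indep A⊆I = ℕₚ.≤-antisym (r-bound A) (ℕₚ.+-cancelʳ-≤ ∣ C ∣ _ _ (begin
    ∣ A ∣ + ∣ C ∣        ≤⟨ ℕₚ.+-monoˡ-≤ ∣ C ∣ (p⊆q⇒∣p∣≤∣q∣ (λ e∈A → x∈p∩q⁺ (A⊆I e∈A , e∈A))) ⟩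
    ∣ I ∩ A ∣ + ∣ C ∣    ≡⟨ ∣p∣≡∣p∩q∣+∣p∩∁q∣ I A ⟨
    ∣ I ∣                ≡⟨ I-indep ⟨
    r I                  ≤⟨ r-mono I (A ∪ C) I⊆A∪C ⟩
    r (A ∪ C)            ≤⟨ r-∪-≤ A C ⟩
    r A + ∣ C ∣          ∎))
    where
    open ℕₚ.≤-Reasoning
    C : Subset n
    C = I ∩ ∁ A
    I⊆A∪C : I ⊆ A ∪ C
    I⊆A∪C {e} e∈I with e ∈? A
    ... | yes e∈A = p⊆p∪q C e∈A
    ... | no  e∉A = q⊆p∪q A C (x∈p∩q⁺ (e∈I , x∉p⇒x∈∁p e∉A))

  independent-∪⁅⁆-cases : ∀ {I e} → Independent M I → e ∉ I →
    r (I ∪ ⁅ e ⁆) ≡ r I ⊎ Independent M (I ∪ ⁅ e ⁆)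
  independent-∪⁅⁆-cases {I} {e} I-indep e∉I with r[A∪⁅e⁆]-cases I e
  ... | inj₁ same = inj₁ same
  ... | inj₂ jump = inj₂ (trans jump (trans (cong suc I-indep) (sym (x∉p⇒∣p∪⁅x⁆∣≡1+∣p∣ e∉I))))

  r-∪fromList-spanned : ∀ B L → (∀ e → e ∈ₗ L → r (B ∪ ⁅ e ⁆) ≡ r B) → r (B ∪ fromList L) ≡ r B
  r-∪fromList-spanned B []      _       = cong r (∪-identityʳ B)
  r-∪fromList-spanned B (e ∷ L) spanned = ℕₚ.≤-antisym (ℕₚ.+-cancelʳ-≤ (r B) _ _ (begin
    r (B ∪ fromList (e ∷ L)) + r B  ≡⟨ cong (λ X → r X + r B) B∪eL≡A∪C ⟩
    r (A ∪ C) + r B                 ≤⟨ ℕₚ.+-monoʳ-≤ (r (A ∪ C)) (r-mono B (A ∩ C) B⊆A∩C) ⟩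
    r (A ∪ C) + r (A ∩ C)           ≤⟨ r-submod A C ⟩
    r A + r C                       ≡⟨ cong₂ _+_ (spanned e (here refl)) (r-∪fromList-spanned B L (λ e′ → spanned e′ ∘ there)) ⟩
    r B + r B                       ∎)) (r-mono B _ (p⊆p∪q _))
    where
    open ℕₚ.≤-Reasoning
    A C : Subset n
    A = B ∪ ⁅ e ⁆
    C = B ∪ fromList L
    B∪eL≡A∪C : B ∪ fromList (e ∷ L) ≡ A ∪ C
    B∪eL≡A∪C = solve 3 (λ b e l → b ⊕ (e ⊕ l) ⊜ (b ⊕ e) ⊕ (b ⊕ l)) refl B ⁅ e ⁆ (fromList L)
      where open ∪-Solver
    B⊆A∩C : B ⊆ A ∩ C
    B⊆A∩C b∈B = x∈p∩q⁺ (p⊆p∪q ⁅ e ⁆ b∈B , p⊆p∪q (fromList L) b∈B)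

  r-∪-spanned : ∀ B S → (∀ e → e ∈ S → r (B ∪ ⁅ e ⁆) ≡ r B) → r (B ∪ S) ≡ r B
  r-∪-spanned B S spanned = subst (λ X → r (B ∪ X) ≡ r B) (fromList-toList S)
    (r-∪fromList-spanned B (toList S) (λ e e∈ → spanned e (subst (e ∈_) (fromList-toList S) (∈-fromList⁺ e∈))))

  basis-intro : ∀ {S B} → B ⊆ S → Independent M B → ∣ B ∣ ≡ r S → BasisOf M S B
  basis-intro {S} {B} B⊆S B-indep ∣B∣≡rS = B⊆S , B-indep , λ e e∈S e∉B B+e-indep →
    ℕₚ.1+n≰n (begin
      suc ∣ B ∣        ≡⟨ x∉p⇒∣p∪⁅x⁆∣≡1+∣p∣ e∉B ⟨
      ∣ B ∪ ⁅ e ⁆ ∣    ≤⟨ independent⇒∣I∣≤r B+e-indep (p⊆r⇒x∈r⇒p∪⁅x⁆⊆r B⊆S e∈S) ⟩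
      r S              ≡⟨ ∣B∣≡rS ⟨
      ∣ B ∣            ∎)
    where open ℕₚ.≤-Reasoning

  basis-spans : ∀ {S B} → BasisOf M S B → ∀ e → e ∈ S → r (B ∪ ⁅ e ⁆) ≡ r B
  basis-spans {B = B} (_ , B-indep , maximal) e e∈S with e ∈? B
  ... | yes e∈B = cong r (x∈p⇒p∪⁅x⁆≡p e∈B)
  ... | no  e∉B with independent-∪⁅⁆-cases B-indep e∉B
  ...   | inj₁ same        = same
  ...   | inj₂ B+e-indep   = ⊥-elim (maximal e e∈S e∉B B+e-indep)

  basis-size : ∀ {S B} → BasisOf M S B → ∣ B ∣ ≡ r S
  basis-size {S} {B} bB@(B⊆S , B-indep , _) = ℕₚ.≤-antisym (independent⇒∣I∣≤r B-indep B⊆S) (begin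
    r S          ≤⟨ r-mono S (B ∪ S) (q⊆p∪q B S) ⟩
    r (B ∪ S)    ≡⟨ r-∪-spanned B S (basis-spans bB) ⟩
    r B          ≡⟨ B-indep ⟩
    ∣ B ∣        ∎)
    where open ℕₚ.≤-Reasoning

  r-basis : ∀ {S B} → BasisOf M S B → r B ≡ r S
  r-basis bB@(_ , B-indep , _) = trans B-indep (basis-size bB)

  independent-∪⁅⁆ : ∀ {S I e} → BasisOf M S I → e ∉ S → r (S ∪ ⁅ e ⁆) ≡ suc (r S) →
    Independent M (I ∪ ⁅ e ⁆)
  independent-∪⁅⁆ {S} {I} {e} bI@(I⊆S , I-indep , _) e∉S jump
    with independent-∪⁅⁆-cases I-indep (e∉S ∘ I⊆S)
  ... | inj₂ I+e-indep = I+e-indep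
  ... | inj₁ same      = ⊥-elim (ℕₚ.1+n≰n (begin
    suc (r S)              ≡⟨ jump ⟨
    r (S ∪ ⁅ e ⁆)          ≤⟨ r-mono _ _ (q⊆p∪q I (S ∪ ⁅ e ⁆)) ⟩
    r (I ∪ (S ∪ ⁅ e ⁆))    ≡⟨ r-∪-spanned I (S ∪ ⁅ e ⁆) spanned ⟩
    r I                    ≡⟨ r-basis bI ⟩
    r S                    ∎))
    where
    open ℕₚ.≤-Reasoning
    spanned : ∀ s → s ∈ S ∪ ⁅ e ⁆ → r (I ∪ ⁅ s ⁆) ≡ r I
    spanned s s∈ with x∈p∪q⁻ S ⁅ e ⁆ s∈
    ... | inj₁ s∈S   = basis-spans bI s s∈S
    ... | inj₂ s∈⁅e⁆ = subst (λ t → r (I ∪ ⁅ t ⁆) ≡ r I) (sym (x∈⁅y⁆⇒x≡y e s∈⁅e⁆)) same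

  basis-∪⁅⁆ : ∀ {S I} → BasisOf M S I → ∀ e → ∃[ I′ ] I ⊆ I′ × BasisOf M (S ∪ ⁅ e ⁆) I′
  basis-∪⁅⁆ {S} {I} bI@(I⊆S , I-indep , _) e with r[A∪⁅e⁆]-cases S e
  ... | inj₁ same = I , (λ e∈I → e∈I) ,
    basis-intro (p⊆p∪q ⁅ e ⁆ ∘ I⊆S) I-indep (trans (basis-size bI) (sym same))
  ... | inj₂ jump = I ∪ ⁅ e ⁆ , p⊆p∪q ⁅ e ⁆ ,
    basis-intro (∪-monoˡ-⊆ ⁅ e ⁆ I⊆S) (independent-∪⁅⁆ bI e∉S jump)
      (trans (x∉p⇒∣p∪⁅x⁆∣≡1+∣p∣ (e∉S ∘ I⊆S)) (trans (cong suc (basis-size bI)) (sym jump)))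
    where
    e∉S : e ∉ S
    e∉S e∈S = ℕₚ.1+n≢n (trans (sym jump) (cong r (x∈p⇒p∪⁅x⁆≡p e∈S)))

  ⊥-basis : BasisOf M ⊥ ⊥
  ⊥-basis = basis-intro (λ e∈⊥ → e∈⊥) (trans r-⊥ (sym (∣⊥∣≡0 n))) (trans (∣⊥∣≡0 n) (sym r-⊥))

  Tight : Subset n → Subset n → Set
  Tight B T = ∣ B ∩ T ∣ ≡ r T

  independent⇒∣∩∣≤r : ∀ {B} T → Independent M B → ∣ B ∩ T ∣ ≤ r T
  independent⇒∣∩∣≤r {B} T B-indep =
    independent⇒∣I∣≤r (independent-⊆ B-indep (p∩q⊆p B T)) (p∩q⊆q B T)

  ⊇basis⇒tight : ∀ {G I S} → Independent M G → I ⊆ G → BasisOf M S I → Tight G S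
  ⊇basis⇒tight {G} {I} {S} G-indep I⊆G bI@(I⊆S , _) =
    ℕₚ.≤-antisym (independent⇒∣∩∣≤r S G-indep)
      (subst (_≤ ∣ G ∩ S ∣) (basis-size bI) (p⊆q⇒∣p∣≤∣q∣ (λ e∈I → x∈p∩q⁺ (I⊆G e∈I , I⊆S e∈I))))

  PrefixTight : List (Fin n) → Subset n → Set
  PrefixTight L G = ∀ as bs → L ≡ as ++ bs → Tight G (fromList as)

  greedy-from : ∀ {S I} → BasisOf M S I → ∀ L →
    ∃[ G ] I ⊆ G × BasisOf M (S ∪ fromList L) G ×
           (∀ as bs → L ≡ as ++ bs → Tight G (S ∪ fromList as))
  greedy-from {S} {I} bI [] = I , (λ e∈I → e∈I) , subst (λ T → BasisOf M T I) (sym (∪-identityʳ S)) bI , tight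
    where
    tight : ∀ as bs → [] ≡ as ++ bs → Tight I (S ∪ fromList as)
    tight [] _ _ = subst (Tight I) (sym (∪-identityʳ S)) (⊇basis⇒tight (proj₁ (proj₂ bI)) (λ e∈I → e∈I) bI)
  greedy-from {S} {I} bI (e ∷ L) with basis-∪⁅⁆ bI e
  ... | I′ , I⊆I′ , bI′ with greedy-from bI′ L
  ...   | G , I′⊆G , bG , tight =
    G , I′⊆G ∘ I⊆I′ , subst (λ T → BasisOf M T G) (∪-assoc S ⁅ e ⁆ (fromList L)) bG , tight′
    where
    tight′ : ∀ as bs → e ∷ L ≡ as ++ bs → Tight G (S ∪ fromList as)
    tight′ []       _  _ = subst (Tight G) (sym (∪-identityʳ S)) (⊇basis⇒tight (proj₁ (proj₂ bG)) (I′⊆G ∘ I⊆I′) bI)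
    tight′ (a ∷ as) bs eq with Listₚ.∷-injective eq
    ... | refl , L≡as++bs = subst (Tight G) (∪-assoc S ⁅ e ⁆ (fromList as)) (tight as bs L≡as++bs)

  greedy-basis : ∀ L → (∀ e → e ∈ₗ L) → ∃[ G ] Basis M G × PrefixTight L G
  greedy-basis L covers with greedy-from ⊥-basis L
  ... | G , _ , bG , tight =
    G , subst (λ T → BasisOf M T G) (trans (∪-identityˡ _) (fromList-covering L covers)) bG ,
    λ as bs L≡as++bs → subst (Tight G) (∪-identityˡ _) (tight as bs L≡as++bs)

  basis-exists : ∀ S → ∃ (BasisOf M S)
  basis-exists S with greedy-from ⊥-basis (toList S)
  ... | G , _ , bG , _ = G , subst (λ T → BasisOf M T G) (trans (∪-identityˡ _) (fromList-toList S)) bG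

  private
    independent? : ∀ A → Dec (Independent M A)
    independent? A = r A ℕ.≟ ∣ A ∣

    circuit-within : ∀ k D → ∣ D ∣ < k → ¬ Independent M D → ∃[ C ] Circuit M C × C ⊆ D
    circuit-within (suc k) D (s≤s ∣D∣≤k) D-dep
      with Finₚ.any? (λ e → (e ∈? D) ×-dec ¬? (independent? (D - e)))
    ... | no  none = D , (D-dep , minimal) , λ e∈D → e∈D
      where
      minimal : ∀ e → e ∈ D → Independent M (D - e)
      minimal e e∈D = decidable-stable (independent? (D - e)) (λ D-e-dep → none (e , e∈D , D-e-dep))
    ... | yes (e , e∈D , D-e-dep)
      with circuit-within k (D - e) (ℕₚ.<-≤-trans (x∈p⇒∣p-x∣<∣p∣ e∈D) ∣D∣≤k) D-e-dep
    ...   | C , C-circuit , C⊆D-e = C , C-circuit , p─q⊆p D ⁅ e ⁆ ∘ C⊆D-e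

  dependent⇒circuit : ∀ D → ¬ Independent M D → ∃[ C ] Circuit M C × C ⊆ D
  dependent⇒circuit D = circuit-within (suc ∣ D ∣) D ℕₚ.≤-refl

  circuit⇒r[C]≡r[C-e] : ∀ {C e} → Circuit M C → e ∈ C → r C ≡ r (C - e)
  circuit⇒r[C]≡r[C-e] {C} {e} (C-dep , C-e-indep) e∈C = ℕₚ.≤-antisym (ℕₚ.m<1+n⇒m≤n (begin-strict
    r C                  <⟨ ℕₚ.≤∧≢⇒< (r-bound C) C-dep ⟩
    ∣ C ∣                ≡⟨ cong ∣_∣ (x∈p⇒p-x∪⁅x⁆≡p e∈C) ⟨
    ∣ (C - e) ∪ ⁅ e ⁆ ∣  ≡⟨ x∉p⇒∣p∪⁅x⁆∣≡1+∣p∣ (x∉p-x C e) ⟩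
    suc ∣ C - e ∣        ≡⟨ cong suc (C-e-indep e e∈C) ⟨
    suc (r (C - e))      ∎)) (r-mono (C - e) C (p─q⊆p C ⁅ e ⁆))
    where open ℕₚ.≤-Reasoning

  circuit⇒r[A∪⁅e⁆]≡r[A] : ∀ {C e A} → Circuit M C → e ∈ C → C - e ⊆ A → r (A ∪ ⁅ e ⁆) ≡ r A
  circuit⇒r[A∪⁅e⁆]≡r[A] {C} {e} {A} C-circuit e∈C C-e⊆A =
    ℕₚ.≤-antisym (ℕₚ.≤-trans (r-mono _ _ (∪-monoʳ-⊆ A ⁅e⁆⊆C)) (ℕₚ.+-cancelʳ-≤ (r (A ∩ C)) _ _ (begin
      r (A ∪ C) + r (A ∩ C)  ≤⟨ r-submod A C ⟩
      r A + r C              ≡⟨ cong (r A +_) (circuit⇒r[C]≡r[C-e] C-circuit e∈C) ⟩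
      r A + r (C - e)        ≤⟨ ℕₚ.+-monoʳ-≤ (r A) (r-mono _ _ (λ c∈ → x∈p∩q⁺ (C-e⊆A c∈ , p─q⊆p C ⁅ e ⁆ c∈))) ⟩
      r A + r (A ∩ C)        ∎)))
      (r-mono A _ (p⊆p∪q ⁅ e ⁆))
    where
    open ℕₚ.≤-Reasoning
    ⁅e⁆⊆C : ⁅ e ⁆ ⊆ C
    ⁅e⁆⊆C e′∈ = subst (_∈ C) (sym (x∈⁅y⁆⇒x≡y e e′∈)) e∈C

  circuit-⊆-∪⁅⁆ : ∀ {I C e} → Independent M I → Circuit M C → C ⊆ I ∪ ⁅ e ⁆ → e ∈ C
  circuit-⊆-∪⁅⁆ {I} {C} {e} I-indep (C-dep , _) C⊆I+e with e ∈? C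
  ... | yes e∈C = e∈C
  ... | no  e∉C = ⊥-elim (C-dep (independent-⊆ I-indep C⊆I))
    where
    C⊆I : C ⊆ I
    C⊆I {c} c∈C with x∈p∪q⁻ I ⁅ e ⁆ (C⊆I+e c∈C)
    ... | inj₁ c∈I   = c∈I
    ... | inj₂ c∈⁅e⁆ = ⊥-elim (e∉C (subst (_∈ C) (x∈⁅y⁆⇒x≡y e c∈⁅e⁆) c∈C))

  greedy-optimal : ∀ {L G} → Unique L → (∀ e → e ∈ₗ L) → Basis M G → PrefixTight L G →
    ∀ x → Descending x L → ∀ B → Basis M B → weight x B ℚ.≤ weight x G
  greedy-optimal {L} {G} L-unique covers bG G-tight x descending B bB@(_ , B-indep , _) =
    subst₂ ℚ._≤_ (as-sum B) (as-sum G) (abel-≤ x (count B) (count G) L descending prefix total)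
    where
    count : Subset n → Fin n → ℕ
    count X e = ∣ X ∩ ⁅ e ⁆ ∣
    X∩L≡X : ∀ X → X ∩ fromList L ≡ X
    X∩L≡X X = trans (cong (X ∩_) (fromList-covering L covers)) (∩-identityʳ X)
    as-sum : ∀ X → weightedSum x (count X) L ≡ weight x X
    as-sum X = trans (sym (weight-∩fromList x X L L-unique)) (cong (weight x) (X∩L≡X X))
    prefix : ∀ as bs → L ≡ as ++ bs → sum (List.map (count B) as) ≤ sum (List.map (count G) as)
    prefix as bs L≡as++bs = subst₂ _≤_ (∣∩fromList∣ B as as-unique) (∣∩fromList∣ G as as-unique)
      (subst (∣ B ∩ fromList as ∣ ≤_) (sym (G-tight as bs L≡as++bs)) (independent⇒∣∩∣≤r (fromList as) B-indep))
      where as-unique = unique-prefix as (subst Unique L≡as++bs L-unique)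
    total : sum (List.map (count B) L) ≡ sum (List.map (count G) L)
    total = begin
      sum (List.map (count B) L)  ≡⟨ ∣∩fromList∣ B L L-unique ⟨
      ∣ B ∩ fromList L ∣          ≡⟨ cong ∣_∣ (X∩L≡X B) ⟩
      ∣ B ∣                       ≡⟨ trans (basis-size bB) (sym (basis-size bG)) ⟩
      ∣ G ∣                       ≡⟨ cong ∣_∣ (X∩L≡X G) ⟨
      ∣ G ∩ fromList L ∣          ≡⟨ ∣∩fromList∣ G L L-unique ⟩
      sum (List.map (count G) L)  ∎
      where open ≡-Reasoning

  tight-if-≥-tight : ∀ {X G T} → Independent M X → Tight G T → ∣ G ∩ T ∣ ≤ ∣ X ∩ T ∣ → Tight X T
  tight-if-≥-tight {X} {G} {T} X-indep G-tight ≥G =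
    ℕₚ.≤-antisym (independent⇒∣∩∣≤r T X-indep) (subst (_≤ ∣ X ∩ T ∣) G-tight ≥G)

  tight-if-complement-≤ : ∀ {B G T} → Basis M B → Basis M G → Tight G T →
    ∣ B ∩ ∁ T ∣ ≤ ∣ G ∩ ∁ T ∣ → Tight B T
  tight-if-complement-≤ {B} {G} {T} bB bG G-tight B∁≤G∁ =
    ℕₚ.≤-antisym (independent⇒∣∩∣≤r T (proj₁ (proj₂ bB))) (ℕₚ.+-cancelʳ-≤ ∣ G ∩ ∁ T ∣ _ _ (begin
      r T + ∣ G ∩ ∁ T ∣              ≡⟨ cong (_+ ∣ G ∩ ∁ T ∣) G-tight ⟨
      ∣ G ∩ T ∣ + ∣ G ∩ ∁ T ∣        ≡⟨ ∣p∣≡∣p∩q∣+∣p∩∁q∣ G T ⟨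
      ∣ G ∣                          ≡⟨ trans (basis-size bG) (sym (basis-size bB)) ⟩
      ∣ B ∣                          ≡⟨ ∣p∣≡∣p∩q∣+∣p∩∁q∣ B T ⟩
      ∣ B ∩ T ∣ + ∣ B ∩ ∁ T ∣        ≤⟨ ℕₚ.+-monoʳ-≤ ∣ B ∩ T ∣ B∁≤G∁ ⟩
      ∣ B ∩ T ∣ + ∣ G ∩ ∁ T ∣        ∎))
    where open ℕₚ.≤-Reasoning

-- The conditions (1)–(6)

module Local {n : ℕ} (M : Matroid n) (K : Subset n) (i j : Fin n)
             (i≢j : i ≢ j) (i∉K : i ∉ K) (j∉K : j ∉ K) where
  open Matroid M

  iK jK ijK : Subset n
  iK  = ⁅ i ⁆ ∪ K
  jK  = ⁅ j ⁆ ∪ K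
  ijK = ⁅ i ⁆ ∪ ⁅ j ⁆ ∪ K

  RanksJump : Set
  RanksJump = r iK ≡ suc (r K) × r jK ≡ suc (r K) × r ijK ≡ suc (r K)

  B₀ : Subset n
  B₀ = proj₁ (basis-exists M K)

  bB₀ : BasisOf M K B₀
  bB₀ = proj₂ (basis-exists M K)

  B₀⊆K : B₀ ⊆ K
  B₀⊆K = proj₁ bB₀

  ⁅a⁆∪K≡K∪⁅a⁆ : ∀ a → ⁅ a ⁆ ∪ K ≡ K ∪ ⁅ a ⁆
  ⁅a⁆∪K≡K∪⁅a⁆ a = ∪-comm ⁅ a ⁆ K

  i∈ijK : i ∈ ijK
  i∈ijK = p⊆p∪q (⁅ j ⁆ ∪ K) (x∈⁅x⁆ i)

  j∈ijK : j ∈ ijK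
  j∈ijK = q⊆p∪q ⁅ i ⁆ _ (p⊆p∪q K (x∈⁅x⁆ j))

  K⊆ijK : K ⊆ ijK
  K⊆ijK = q⊆p∪q ⁅ i ⁆ _ ∘ q⊆p∪q ⁅ j ⁆ K

  ⁅a⁆∪K⊆ijK : ∀ {a} → a ∈ ijK → ⁅ a ⁆ ∪ K ⊆ ijK
  ⁅a⁆∪K⊆ijK a∈ijK = subst (_⊆ ijK) (sym (⁅a⁆∪K≡K∪⁅a⁆ _)) (p⊆r⇒x∈r⇒p∪⁅x⁆⊆r K⊆ijK a∈ijK)

  ∈ijK∖ij⇒∈K : ∀ {e} → e ∈ ijK → e ≢ i → e ≢ j → e ∈ K
  ∈ijK∖ij⇒∈K {e} e∈ e≢i e≢j with x∈p∪q⁻ ⁅ i ⁆ _ e∈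
  ... | inj₁ e∈⁅i⁆ = ⊥-elim (e≢i (x∈⁅y⁆⇒x≡y i e∈⁅i⁆))
  ... | inj₂ e∈jK with x∈p∪q⁻ ⁅ j ⁆ K e∈jK
  ...   | inj₁ e∈⁅j⁆ = ⊥-elim (e≢j (x∈⁅y⁆⇒x≡y j e∈⁅j⁆))
  ...   | inj₂ e∈K   = e∈K

  ijK≡iK∪⁅j⁆ : ijK ≡ iK ∪ ⁅ j ⁆
  ijK≡iK∪⁅j⁆ = solve 3 (λ a b k → a ⊕ (b ⊕ k) ⊜ (a ⊕ k) ⊕ b) refl ⁅ i ⁆ ⁅ j ⁆ K
    where open ∪-Solver

  ijK≡jK∪⁅i⁆ : ijK ≡ jK ∪ ⁅ i ⁆
  ijK≡jK∪⁅i⁆ = solve 3 (λ a b k → a ⊕ (b ⊕ k) ⊜ (b ⊕ k) ⊕ a) refl ⁅ i ⁆ ⁅ j ⁆ K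
    where open ∪-Solver

  r[ijK]+r[K]≤r[iK]+r[jK] : r ijK + r K ≤ r iK + r jK
  r[ijK]+r[K]≤r[iK]+r[jK] = subst₂ (λ U I → r U + r I ≤ r iK + r jK) iK∪jK≡ijK iK∩jK≡K (r-submod iK jK)
    where
    open ≡-Reasoning
    iK∪jK≡ijK : iK ∪ jK ≡ ijK
    iK∪jK≡ijK = solve 3 (λ a b k → (a ⊕ k) ⊕ (b ⊕ k) ⊜ a ⊕ (b ⊕ k)) refl ⁅ i ⁆ ⁅ j ⁆ K
      where open ∪-Solver
    iK∩jK≡K : iK ∩ jK ≡ K
    iK∩jK≡K = begin
      (⁅ i ⁆ ∪ K) ∩ (⁅ j ⁆ ∪ K)  ≡⟨ ∪-distribʳ-∩ K ⁅ i ⁆ ⁅ j ⁆ ⟨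
      (⁅ i ⁆ ∩ ⁅ j ⁆) ∪ K        ≡⟨ cong (_∪ K) (x∉p⇒p∩⁅x⁆≡⊥ (x≢y⇒x∉⁅y⁆ (i≢j ∘ sym))) ⟩
      ⊥ ∪ K                      ≡⟨ ∪-identityˡ K ⟩
      K                          ∎

  r[⁅a⁆∪K]≤1+r[K] : ∀ a → r (⁅ a ⁆ ∪ K) ≤ suc (r K)
  r[⁅a⁆∪K]≤1+r[K] a = subst (λ X → r X ≤ suc (r K)) (sym (⁅a⁆∪K≡K∪⁅a⁆ a)) (r[A∪⁅e⁆]≤1+r[A] M K a)

  ranksJump⇒¬bracket : RanksJump → ¬ InBracket M i j K
  ranksJump⇒¬bracket (r-iK , r-jK , r-ijK) bracket = ℕₚ.1+n≢n (ℕₚ.+-cancelˡ-≡ (suc (r K)) _ _ (begin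
    suc (r K) + suc (r K)  ≡⟨ cong₂ _+_ r-iK r-jK ⟨
    r iK + r jK            ≡⟨ bracket ⟩
    r ijK + r K            ≡⟨ cong (_+ r K) r-ijK ⟩
    suc (r K) + r K        ∎))
    where open ≡-Reasoning

  ¬bracket⇒ranksJump : ¬ InBracket M i j K → RanksJump
  ¬bracket⇒ranksJump ¬bracket = c+k<a+b⇒a≡b≡c≡1+k (r[⁅a⁆∪K]≤1+r[K] i) (r[⁅a⁆∪K]≤1+r[K] j)
    (r-mono iK ijK (⁅a⁆∪K⊆ijK i∈ijK)) (r-mono jK ijK (⁅a⁆∪K⊆ijK j∈ijK))
    (ℕₚ.≤∧≢⇒< r[ijK]+r[K]≤r[iK]+r[jK] (¬bracket ∘ sym))

  ∈ijK∖j⇒∈iK : ∀ {e} → e ∈ ijK → e ≢ j → e ∈ iK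
  ∈ijK∖j⇒∈iK {e} e∈ e≢j with e Fin.≟ i
  ... | yes refl = p⊆p∪q K (x∈⁅x⁆ e)
  ... | no  e≢i  = q⊆p∪q ⁅ i ⁆ K (∈ijK∖ij⇒∈K e∈ e≢i e≢j)

  ∈ijK∖i⇒∈jK : ∀ {e} → e ∈ ijK → e ≢ i → e ∈ jK
  ∈ijK∖i⇒∈jK {e} e∈ e≢i with e Fin.≟ j
  ... | yes refl = p⊆p∪q K (x∈⁅x⁆ e)
  ... | no  e≢j  = q⊆p∪q ⁅ j ⁆ K (∈ijK∖ij⇒∈K e∈ e≢i e≢j)

  ranksJump⇔hyperplane : RanksJump ⇔ HyperplaneOf M ijK K
  ranksJump⇔hyperplane = mk⇔ to from
    where
    to : RanksJump → HyperplaneOf M ijK K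
    to (r-iK , r-jK , r-ijK) = (K⊆ijK , flat) , sym r-ijK
      where
      flat : ∀ e → e ∈ ijK → e ∉ K → r (K ∪ ⁅ e ⁆) ≡ suc (r K)
      flat e e∈ e∉K with e Fin.≟ i | e Fin.≟ j
      ... | yes refl | _        = trans (cong r (sym (⁅a⁆∪K≡K∪⁅a⁆ e))) r-iK
      ... | no  _    | yes refl = trans (cong r (sym (⁅a⁆∪K≡K∪⁅a⁆ e))) r-jK
      ... | no  e≢i  | no  e≢j  = ⊥-elim (e∉K (∈ijK∖ij⇒∈K e∈ e≢i e≢j))
    from : HyperplaneOf M ijK K → RanksJump
    from ((_ , flat) , 1+rK≡r-ijK) =
      trans (cong r (⁅a⁆∪K≡K∪⁅a⁆ i)) (flat i i∈ijK i∉K) ,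
      trans (cong r (⁅a⁆∪K≡K∪⁅a⁆ j)) (flat j j∈ijK j∉K) ,
      sym 1+rK≡r-ijK

  ExtendsEveryBasis ExtendsSomeBasis : Set
  ExtendsEveryBasis = ∀ B → BasisOf M K B → BasisOf M ijK (⁅ i ⁆ ∪ B) × BasisOf M ijK (⁅ j ⁆ ∪ B)
  ExtendsSomeBasis = ∃[ B ] (BasisOf M K B × BasisOf M ijK (⁅ i ⁆ ∪ B) × BasisOf M ijK (⁅ j ⁆ ∪ B))

  ∣⁅a⁆∪B∣≡1+rK : ∀ {a B} → a ∉ K → BasisOf M K B → ∣ ⁅ a ⁆ ∪ B ∣ ≡ suc (r K)
  ∣⁅a⁆∪B∣≡1+rK {a} {B} a∉K bB@(B⊆K , _) =
    trans (cong ∣_∣ (∪-comm ⁅ a ⁆ B)) (trans (x∉p⇒∣p∪⁅x⁆∣≡1+∣p∣ (a∉K ∘ B⊆K)) (cong suc (basis-size M bB)))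

  extended-basis : ∀ {a B} → a ∈ ijK → a ∉ K → r (⁅ a ⁆ ∪ K) ≡ suc (r K) → r ijK ≡ suc (r K) →
    BasisOf M K B → BasisOf M ijK (⁅ a ⁆ ∪ B)
  extended-basis {a} {B} a∈ijK a∉K r-aK r-ijK bB@(B⊆K , _) =
    basis-intro M (⁅a⁆∪K⊆ijK a∈ijK ∘ ∪-monoʳ-⊆ ⁅ a ⁆ B⊆K)
      (subst (Independent M) (∪-comm B ⁅ a ⁆) (independent-∪⁅⁆ M bB a∉K (trans (cong r (sym (⁅a⁆∪K≡K∪⁅a⁆ a))) r-aK)))
      (trans (∣⁅a⁆∪B∣≡1+rK a∉K bB) (sym r-ijK))

  ranksJump⇒extendsEvery : RanksJump → ExtendsEveryBasis
  ranksJump⇒extendsEvery (r-iK , r-jK , r-ijK) B bB =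
    extended-basis i∈ijK i∉K r-iK r-ijK bB , extended-basis j∈ijK j∉K r-jK r-ijK bB

  extendsEvery⇒extendsSome : ExtendsEveryBasis → ExtendsSomeBasis
  extendsEvery⇒extendsSome extends = B₀ , bB₀ , extends B₀ bB₀

  extendsSome⇒ranksJump : ExtendsSomeBasis → RanksJump
  extendsSome⇒ranksJump (B , bB@(B⊆K , _) , biB , bjB) =
    r-aK i i∉K biB , r-aK j j∉K bjB , trans (sym (basis-size M biB)) (∣⁅a⁆∪B∣≡1+rK i∉K bB)
    where
    r-aK : ∀ a → a ∉ K → BasisOf M ijK (⁅ a ⁆ ∪ B) → r (⁅ a ⁆ ∪ K) ≡ suc (r K)
    r-aK a a∉K (_ , aB-indep , _) = ℕₚ.≤-antisym (r[⁅a⁆∪K]≤1+r[K] a)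
      (subst (_≤ r (⁅ a ⁆ ∪ K)) (∣⁅a⁆∪B∣≡1+rK a∉K bB) (independent⇒∣I∣≤r M aB-indep (∪-monoʳ-⊆ ⁅ a ⁆ B⊆K)))

  D : Subset n
  D = ⁅ i ⁆ ∪ ⁅ j ⁆

  i∈D : i ∈ D
  i∈D = p⊆p∪q ⁅ j ⁆ (x∈⁅x⁆ i)

  j∈D : j ∈ D
  j∈D = q⊆p∪q ⁅ i ⁆ ⁅ j ⁆ (x∈⁅x⁆ j)

  D⊆ijK : D ⊆ ijK
  D⊆ijK = ∪-monoʳ-⊆ ⁅ i ⁆ (p⊆p∪q K)

  D∩K≡∅ : ∀ {e} → e ∈ D → e ∉ K
  D∩K≡∅ e∈D with x∈p∪q⁻ ⁅ i ⁆ ⁅ j ⁆ e∈D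
  ... | inj₁ e∈⁅i⁆ = subst (_∉ K) (sym (x∈⁅y⁆⇒x≡y i e∈⁅i⁆)) i∉K
  ... | inj₂ e∈⁅j⁆ = subst (_∉ K) (sym (x∈⁅y⁆⇒x≡y j e∈⁅j⁆)) j∉K

  ⁅a⁆⊆D : ∀ {a} → a ∈ D → ⁅ a ⁆ ⊆ D
  ⁅a⁆⊆D {a} a∈D e∈⁅a⁆ = subst (_∈ D) (sym (x∈⁅y⁆⇒x≡y a e∈⁅a⁆)) a∈D

  ranksJump⇒cocircuit : RanksJump → CocircuitOf M ijK D
  ranksJump⇒cocircuit jumps@(_ , _ , r-ijK) = D⊆ijK , meets , minimal
    where
    meets : MeetsAllBases M ijK D
    meets B bB@(B⊆ijK , B-indep , _) with i ∈? B | j ∈? B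
    ... | yes i∈B | _       = i , i∈D , i∈B
    ... | no  _   | yes j∈B = j , j∈D , j∈B
    ... | no  i∉B | no  j∉B = ⊥-elim (ℕₚ.1+n≰n (begin
      suc (r K)  ≡⟨ trans (sym r-ijK) (sym (basis-size M bB)) ⟩
      ∣ B ∣      ≤⟨ independent⇒∣I∣≤r M B-indep B⊆K ⟩
      r K        ∎))
      where
      open ℕₚ.≤-Reasoning
      B⊆K : B ⊆ K
      B⊆K e∈B = ∈ijK∖ij⇒∈K (B⊆ijK e∈B) (λ { refl → i∉B e∈B }) (λ { refl → j∉B e∈B })
    minimal : ∀ D′ → D′ ⊆ D → MeetsAllBases M ijK D′ → D′ ≡ D
    minimal D′ D′⊆D meets′ = ⊆-antisym D′⊆D D⊆D′
      where
      forced : ∀ a → BasisOf M ijK (⁅ a ⁆ ∪ B₀) → a ∈ D′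
      forced a baB₀ with meets′ _ baB₀
      ... | e , e∈D′ , e∈⁅a⁆∪B₀ with x∈p∪q⁻ ⁅ a ⁆ B₀ e∈⁅a⁆∪B₀
      ...   | inj₁ e∈⁅a⁆ = subst (_∈ D′) (x∈⁅y⁆⇒x≡y a e∈⁅a⁆) e∈D′
      ...   | inj₂ e∈B₀  = ⊥-elim (D∩K≡∅ (D′⊆D e∈D′) (B₀⊆K e∈B₀))
      D⊆D′ : D ⊆ D′
      D⊆D′ e∈D with x∈p∪q⁻ ⁅ i ⁆ ⁅ j ⁆ e∈D
      ... | inj₁ e∈⁅i⁆ = subst (_∈ D′) (sym (x∈⁅y⁆⇒x≡y i e∈⁅i⁆)) (forced i (proj₁ (ranksJump⇒extendsEvery jumps B₀ bB₀)))
      ... | inj₂ e∈⁅j⁆ = subst (_∈ D′) (sym (x∈⁅y⁆⇒x≡y j e∈⁅j⁆)) (forced j (proj₂ (ranksJump⇒extendsEvery jumps B₀ bB₀)))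

  cocircuit⇒ranksJump : CocircuitOf M ijK D → RanksJump
  cocircuit⇒ranksJump (_ , meets , minimal) =
    trans r-iK≡r-ijK r-ijK≡1+rK , trans r-jK≡r-ijK r-ijK≡1+rK , r-ijK≡1+rK
    where
    rK<r-ijK : r K < r ijK
    rK<r-ijK = ℕₚ.≤∧≢⇒< (r-mono K ijK K⊆ijK) λ rK≡r-ijK →
      let B₀-basis-of-ijK = basis-intro M (K⊆ijK ∘ B₀⊆K) (proj₁ (proj₂ bB₀)) (trans (basis-size M bB₀) rK≡r-ijK)
          (e , e∈D , e∈B₀) = meets B₀ B₀-basis-of-ijK
      in D∩K≡∅ e∈D (B₀⊆K e∈B₀)
    -- If r (b ∪ K) < r ijK, every basis of M|ijK contains a, and minimality gives D = {a}.
    r-bK≡r-ijK : ∀ a b → a ∈ D → b ∈ D → a ≢ b → (∀ {e} → e ∈ ijK → e ≢ a → e ∈ ⁅ b ⁆ ∪ K) →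
      r (⁅ b ⁆ ∪ K) ≡ r ijK
    r-bK≡r-ijK a b a∈D b∈D a≢b ijK∖a⊆bK with r (⁅ b ⁆ ∪ K) ℕ.≟ r ijK
    ... | yes r-bK≡r-ijK = r-bK≡r-ijK
    ... | no  r-bK≢r-ijK = ⊥-elim (a≢b (sym (x∈⁅y⁆⇒x≡y a (subst (b ∈_) (sym ⁅a⁆≡D) b∈D))))
      where
      r-bK<r-ijK : r (⁅ b ⁆ ∪ K) < r ijK
      r-bK<r-ijK = ℕₚ.≤∧≢⇒< (r-mono _ _ (⁅a⁆∪K⊆ijK (D⊆ijK b∈D))) r-bK≢r-ijK
      a-meets : MeetsAllBases M ijK ⁅ a ⁆
      a-meets B bB@(B⊆ijK , B-indep , _) with a ∈? B
      ... | yes a∈B = a , x∈⁅x⁆ a , a∈B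
      ... | no  a∉B = ⊥-elim (ℕₚ.<-irrefl refl (begin-strict
        ∣ B ∣              ≤⟨ independent⇒∣I∣≤r M B-indep (λ e∈B → ijK∖a⊆bK (B⊆ijK e∈B) (λ { refl → a∉B e∈B })) ⟩
        r (⁅ b ⁆ ∪ K)      <⟨ r-bK<r-ijK ⟩
        r ijK              ≡⟨ basis-size M bB ⟨
        ∣ B ∣              ∎))
        where open ℕₚ.≤-Reasoning
      ⁅a⁆≡D : ⁅ a ⁆ ≡ D
      ⁅a⁆≡D = minimal ⁅ a ⁆ (⁅a⁆⊆D a∈D) a-meets
    r-jK≡r-ijK : r jK ≡ r ijK
    r-jK≡r-ijK = r-bK≡r-ijK i j i∈D j∈D i≢j ∈ijK∖i⇒∈jK
    r-iK≡r-ijK : r iK ≡ r ijK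
    r-iK≡r-ijK = r-bK≡r-ijK j i j∈D i∈D (i≢j ∘ sym) ∈ijK∖j⇒∈iK
    r-ijK≡1+rK : r ijK ≡ suc (r K)
    r-ijK≡1+rK = ℕₚ.≤-antisym (subst (_≤ suc (r K)) r-iK≡r-ijK (r[⁅a⁆∪K]≤1+r[K] i)) rK<r-ijK

  CircuitCondition : Set
  CircuitCondition =
    (∃[ C ] (Circuit M C × i ∈ C × j ∈ C × C ⊆ ijK)) ×
    (∀ C → Circuit M C → C ⊆ ijK → (i ∈ C × j ∈ C) ⊎ (i ∉ C × j ∉ C))

  separating-circuit⇒r[K∪⁅a⁆]≡r[K] : ∀ {C a b} → Circuit M C → C ⊆ ijK → a ∈ C → b ∉ C →
    (∀ {e} → e ∈ ijK → e ≢ a → e ≢ b → e ∈ K) → r (K ∪ ⁅ a ⁆) ≡ r K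
  separating-circuit⇒r[K∪⁅a⁆]≡r[K] {C} {a} C-circuit C⊆ijK a∈C b∉C ijK∖ab⊆K =
    circuit⇒r[A∪⁅e⁆]≡r[A] M C-circuit a∈C λ e∈C-a →
      ijK∖ab⊆K (C⊆ijK (p─q⊆p C ⁅ a ⁆ e∈C-a))
        (x∉⁅y⁆⇒x≢y (x∈p─q⇒x∉q e∈C-a))
        (λ { refl → b∉C (p─q⊆p C ⁅ a ⁆ e∈C-a) })

  ranksJump⇒circuit-through-ij : RanksJump → ∃[ C ] (Circuit M C × i ∈ C × j ∈ C × C ⊆ ijK)
  ranksJump⇒circuit-through-ij (r-iK , r-jK , r-ijK) = C , C-circuit , i∈C , j∈C , IJ⊆ijK ∘ C⊆IJ
    where
    I J IJ : Subset n
    I  = B₀ ∪ ⁅ i ⁆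
    J  = B₀ ∪ ⁅ j ⁆
    IJ = I ∪ ⁅ j ⁆
    I-indep : Independent M I
    I-indep = independent-∪⁅⁆ M bB₀ i∉K (trans (cong r (sym (⁅a⁆∪K≡K∪⁅a⁆ i))) r-iK)
    J-indep : Independent M J
    J-indep = independent-∪⁅⁆ M bB₀ j∉K (trans (cong r (sym (⁅a⁆∪K≡K∪⁅a⁆ j))) r-jK)
    IJ⊆ijK : IJ ⊆ ijK
    IJ⊆ijK = p⊆r⇒x∈r⇒p∪⁅x⁆⊆r (p⊆r⇒x∈r⇒p∪⁅x⁆⊆r (K⊆ijK ∘ B₀⊆K) i∈ijK) j∈ijK
    j∉I : j ∉ I
    j∉I j∈I with x∈p∪q⁻ B₀ ⁅ i ⁆ j∈I
    ... | inj₁ j∈B₀  = j∉K (B₀⊆K j∈B₀)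
    ... | inj₂ j∈⁅i⁆ = i≢j (sym (x∈⁅y⁆⇒x≡y i j∈⁅i⁆))
    IJ-dependent : ¬ Independent M IJ
    IJ-dependent IJ-indep = ℕₚ.1+n≰n (begin
      suc (suc (r K))   ≡⟨ cong (λ k → suc (suc k)) (basis-size M bB₀) ⟨
      suc (suc ∣ B₀ ∣)  ≡⟨ cong suc (x∉p⇒∣p∪⁅x⁆∣≡1+∣p∣ (i∉K ∘ B₀⊆K)) ⟨
      suc ∣ I ∣         ≡⟨ x∉p⇒∣p∪⁅x⁆∣≡1+∣p∣ j∉I ⟨
      ∣ IJ ∣            ≤⟨ independent⇒∣I∣≤r M IJ-indep IJ⊆ijK ⟩
      r ijK             ≡⟨ r-ijK ⟩
      suc (r K)         ∎)
      where open ℕₚ.≤-Reasoning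
    C : Subset n
    C = proj₁ (dependent⇒circuit M IJ IJ-dependent)
    C-circuit : Circuit M C
    C-circuit = proj₁ (proj₂ (dependent⇒circuit M IJ IJ-dependent))
    C⊆IJ : C ⊆ IJ
    C⊆IJ = proj₂ (proj₂ (dependent⇒circuit M IJ IJ-dependent))
    j∈C : j ∈ C
    j∈C = circuit-⊆-∪⁅⁆ M I-indep C-circuit C⊆IJ
    i∈C : i ∈ C
    i∈C = circuit-⊆-∪⁅⁆ M J-indep C-circuit (subst (C ⊆_) IJ≡J∪⁅i⁆ C⊆IJ)
      where
      IJ≡J∪⁅i⁆ : IJ ≡ J ∪ ⁅ i ⁆
      IJ≡J∪⁅i⁆ = solve 3 (λ b a c → (b ⊕ a) ⊕ c ⊜ (b ⊕ c) ⊕ a) refl B₀ ⁅ i ⁆ ⁅ j ⁆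
        where open ∪-Solver

  ranksJump⇒unseparated : RanksJump → ∀ C → Circuit M C → C ⊆ ijK → (i ∈ C × j ∈ C) ⊎ (i ∉ C × j ∉ C)
  ranksJump⇒unseparated (r-iK , r-jK , _) C C-circuit C⊆ijK with i ∈? C | j ∈? C
  ... | yes i∈C | yes j∈C = inj₁ (i∈C , j∈C)
  ... | no  i∉C | no  j∉C = inj₂ (i∉C , j∉C)
  ... | yes i∈C | no  j∉C = ⊥-elim (ℕₚ.1+n≢n (trans (sym (trans (cong r (sym (⁅a⁆∪K≡K∪⁅a⁆ i))) r-iK))
    (separating-circuit⇒r[K∪⁅a⁆]≡r[K] C-circuit C⊆ijK i∈C j∉C ∈ijK∖ij⇒∈K)))
  ... | no  i∉C | yes j∈C = ⊥-elim (ℕₚ.1+n≢n (trans (sym (trans (cong r (sym (⁅a⁆∪K≡K∪⁅a⁆ j))) r-jK))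
    (separating-circuit⇒r[K∪⁅a⁆]≡r[K] C-circuit C⊆ijK j∈C i∉C (λ e∈ e≢j e≢i → ∈ijK∖ij⇒∈K e∈ e≢i e≢j))))

  -- If r (K ∪ a) = r K, then B₀ ∪ a contains a circuit through a avoiding b.
  unseparated⇒r-jumps : ∀ a b → a ∈ ijK → a ∉ K → b ∉ K → b ≢ a →
    (∀ C → Circuit M C → C ⊆ ijK → a ∈ C → b ∈ C) → r (⁅ a ⁆ ∪ K) ≡ suc (r K)
  unseparated⇒r-jumps a b a∈ijK a∉K b∉K b≢a a∈C⇒b∈C with r[A∪⁅e⁆]-cases M K a
  ... | inj₂ jump = trans (cong r (⁅a⁆∪K≡K∪⁅a⁆ a)) jump
  ... | inj₁ same = ⊥-elim (b∉C (a∈C⇒b∈C C C-circuit (A⊆ijK ∘ C⊆A) a∈C))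
    where
    A : Subset n
    A = B₀ ∪ ⁅ a ⁆
    A⊆ijK : A ⊆ ijK
    A⊆ijK = p⊆r⇒x∈r⇒p∪⁅x⁆⊆r (K⊆ijK ∘ B₀⊆K) a∈ijK
    A-dependent : ¬ Independent M A
    A-dependent A-indep = ℕₚ.1+n≰n (begin
      suc (r K)         ≡⟨ cong suc (basis-size M bB₀) ⟨
      suc ∣ B₀ ∣        ≡⟨ x∉p⇒∣p∪⁅x⁆∣≡1+∣p∣ (a∉K ∘ B₀⊆K) ⟨
      ∣ A ∣             ≤⟨ independent⇒∣I∣≤r M A-indep (∪-monoˡ-⊆ ⁅ a ⁆ B₀⊆K) ⟩
      r (K ∪ ⁅ a ⁆)     ≡⟨ same ⟩
      r K               ∎)
      where open ℕₚ.≤-Reasoning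
    C : Subset n
    C = proj₁ (dependent⇒circuit M A A-dependent)
    C-circuit : Circuit M C
    C-circuit = proj₁ (proj₂ (dependent⇒circuit M A A-dependent))
    C⊆A : C ⊆ A
    C⊆A = proj₂ (proj₂ (dependent⇒circuit M A A-dependent))
    a∈C : a ∈ C
    a∈C = circuit-⊆-∪⁅⁆ M (proj₁ (proj₂ bB₀)) C-circuit C⊆A
    b∉C : b ∉ C
    b∉C b∈C with x∈p∪q⁻ B₀ ⁅ a ⁆ (C⊆A b∈C)
    ... | inj₁ b∈B₀  = b∉K (B₀⊆K b∈B₀)
    ... | inj₂ b∈⁅a⁆ = b≢a (x∈⁅y⁆⇒x≡y a b∈⁅a⁆)

  circuits⇒ranksJump : CircuitCondition → RanksJump
  circuits⇒ranksJump ((C₀ , C₀-circuit , i∈C₀ , j∈C₀ , C₀⊆ijK) , unseparated) = r-iK , r-jK , r-ijK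
    where
    r-iK : r iK ≡ suc (r K)
    r-iK = unseparated⇒r-jumps i j i∈ijK i∉K j∉K (i≢j ∘ sym) λ C C-circuit C⊆ijK i∈C →
      [ proj₂ , (λ neither → ⊥-elim (proj₁ neither i∈C)) ]′ (unseparated C C-circuit C⊆ijK)
    r-jK : r jK ≡ suc (r K)
    r-jK = unseparated⇒r-jumps j i j∈ijK j∉K i∉K i≢j λ C C-circuit C⊆ijK j∈C →
      [ proj₁ , (λ neither → ⊥-elim (proj₂ neither j∈C)) ]′ (unseparated C C-circuit C⊆ijK)
    r-ijK : r ijK ≡ suc (r K)
    r-ijK = begin
      r ijK            ≡⟨ cong r ijK≡iK∪⁅j⁆ ⟩
      r (iK ∪ ⁅ j ⁆)   ≡⟨ circuit⇒r[A∪⁅e⁆]≡r[A] M C₀-circuit j∈C₀ (λ e∈C₀-j →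
                            ∈ijK∖j⇒∈iK (C₀⊆ijK (p─q⊆p C₀ ⁅ j ⁆ e∈C₀-j)) (x∉⁅y⁆⇒x≢y (x∈p─q⇒x∉q e∈C₀-j))) ⟩
      r iK             ≡⟨ r-iK ⟩
      suc (r K)        ∎
      where open ≡-Reasoning

  ¬bracket⇔ranksJump : (¬ InBracket M i j K) ⇔ RanksJump
  ¬bracket⇔ranksJump = mk⇔ ¬bracket⇒ranksJump ranksJump⇒¬bracket

  ranksJump⇔chain : RanksJump ⇔ (r iK ≡ r jK × r jK ≡ r ijK × r ijK ≡ suc (r K))
  ranksJump⇔chain = mk⇔
    (λ (r-iK , r-jK , r-ijK) → trans r-iK (sym r-jK) , trans r-jK (sym r-ijK) , r-ijK)
    (λ (iK≡jK , jK≡ijK , r-ijK) → trans iK≡jK (trans jK≡ijK r-ijK) , trans jK≡ijK r-ijK , r-ijK)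

  ranksJump⇔circuits : RanksJump ⇔ CircuitCondition
  ranksJump⇔circuits = mk⇔ (λ jumps → ranksJump⇒circuit-through-ij jumps , ranksJump⇒unseparated jumps) circuits⇒ranksJump

  ranksJump⇔cocircuit : RanksJump ⇔ CocircuitOf M ijK D
  ranksJump⇔cocircuit = mk⇔ ranksJump⇒cocircuit cocircuit⇒ranksJump

  ranksJump⇔extendsEvery : RanksJump ⇔ ExtendsEveryBasis
  ranksJump⇔extendsEvery = mk⇔ ranksJump⇒extendsEvery (extendsSome⇒ranksJump ∘ extendsEvery⇒extendsSome)

  ranksJump⇔extendsSome : RanksJump ⇔ ExtendsSomeBasis
  ranksJump⇔extendsSome = mk⇔ (extendsEvery⇒extendsSome ∘ ranksJump⇒extendsEvery) extendsSome⇒ranksJump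

-- The cone condition (7)

module Cone {n : ℕ} (M : Matroid n) (K : Subset n) (i j : Fin n)
            (i≢j : i ≢ j) (i∉K : i ∉ K) (j∉K : j ∉ K) (ks ls : List (Fin n))
            (ks-orders-K : OrderingOf M K ks) (ls-orders-rest : OrderingOf M (∁ (⁅ i ⁆ ∪ ⁅ j ⁆ ∪ K)) ls) where
  open Matroid M
  open Local M K i j i≢j i∉K j∉K

  L₀ L₁ L₂ : List (Fin n)
  L₀ = ks ++ i ∷ ls
  L₁ = ks ++ i ∷ j ∷ ls
  L₂ = ks ++ j ∷ i ∷ ls

  ∈ks⇒∈K : ∀ {e} → e ∈ₗ ks → e ∈ K
  ∈ks⇒∈K = proj₂ (proj₂ ks-orders-K) _

  ∈K⇒∈ks : ∀ {e} → e ∈ K → e ∈ₗ ks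
  ∈K⇒∈ks = proj₁ (proj₂ ks-orders-K) _

  ∈ls⇒∉ijK : ∀ {e} → e ∈ₗ ls → e ∉ ijK
  ∈ls⇒∉ijK e∈ls = x∈∁p⇒x∉p (proj₂ (proj₂ ls-orders-rest) _ e∈ls)

  ∉ijK⇒∈ls : ∀ {e} → e ∉ ijK → e ∈ₗ ls
  ∉ijK⇒∈ls e∉ijK = proj₁ (proj₂ ls-orders-rest) _ (x∉p⇒x∈∁p e∉ijK)

  fromList-ks : fromList ks ≡ K
  fromList-ks = ⊆-antisym (∈ks⇒∈K ∘ ∈-fromList⁻) (∈-fromList⁺ ∘ ∈K⇒∈ks)

  unique-around : ∀ mid → Unique mid → (∀ {e} → e ∈ₗ mid → e ∈ ijK × e ∉ K) → Unique (ks ++ mid ++ ls)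
  unique-around mid mid-unique mid⊆ijK∖K =
    ++⁺ (proj₁ ks-orders-K) (++⁺ mid-unique (proj₁ ls-orders-rest) mid∩ls) ks∩rest
    where
    mid∩ls : ∀ {e} → ¬ (e ∈ₗ mid × e ∈ₗ ls)
    mid∩ls (e∈mid , e∈ls) = ∈ls⇒∉ijK e∈ls (proj₁ (mid⊆ijK∖K e∈mid))
    ks∩rest : ∀ {e} → ¬ (e ∈ₗ ks × e ∈ₗ mid ++ ls)
    ks∩rest (e∈ks , e∈rest) with ∈-++⁻ mid e∈rest
    ... | inj₁ e∈mid = proj₂ (mid⊆ijK∖K e∈mid) (∈ks⇒∈K e∈ks)
    ... | inj₂ e∈ls  = ∈ls⇒∉ijK e∈ls (K⊆ijK (∈ks⇒∈K e∈ks))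

  L₀-unique : Unique L₀
  L₀-unique = unique-around (i ∷ []) ([] ∷ []) λ { (here refl) → i∈ijK , i∉K }

  L₁-unique : Unique L₁
  L₁-unique = unique-around (i ∷ j ∷ []) ((i≢j ∷ []) ∷ [] ∷ [])
    λ { (here refl) → i∈ijK , i∉K ; (there (here refl)) → j∈ijK , j∉K }

  L₂-unique : Unique L₂
  L₂-unique = unique-around (j ∷ i ∷ []) (((i≢j ∘ sym) ∷ []) ∷ [] ∷ [])
    λ { (here refl) → j∈ijK , j∉K ; (there (here refl)) → i∈ijK , i∉K }

  covers-around : ∀ mid → i ∈ₗ mid → j ∈ₗ mid → ∀ e → e ∈ₗ ks ++ mid ++ ls
  covers-around mid i∈mid j∈mid e with e ∈? K | e Fin.≟ i | e Fin.≟ j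
  ... | yes e∈K | _        | _        = ∈-++⁺ˡ (∈K⇒∈ks e∈K)
  ... | no  _   | yes refl | _        = ∈-++⁺ʳ ks (∈-++⁺ˡ i∈mid)
  ... | no  _   | no  _    | yes refl = ∈-++⁺ʳ ks (∈-++⁺ˡ j∈mid)
  ... | no  e∉K | no  e≢i  | no  e≢j  =
    ∈-++⁺ʳ ks (∈-++⁺ʳ mid (∉ijK⇒∈ls (λ e∈ → e∉K (∈ijK∖ij⇒∈K e∈ e≢i e≢j))))

  InThisCone : (Fin n → ℚ) → Set
  InThisCone = InCone M ks i j ls

  cone⇒descending₁ : ∀ {x} → InThisCone x → Descending x L₁
  cone⇒descending₁ (descending , xi≡xj) = descending-insert ks (sym xi≡xj) descending

  cone⇒descending₂ : ∀ {x} → InThisCone x → Descending x L₂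
  cone⇒descending₂ (descending , xi≡xj) = descending-insert ks xi≡xj (descending-replace ks (sym xi≡xj) descending)

  covers₁ : ∀ e → e ∈ₗ L₁
  covers₁ = covers-around (i ∷ j ∷ []) (here refl) (there (here refl))

  covers₂ : ∀ e → e ∈ₗ L₂
  covers₂ = covers-around (j ∷ i ∷ []) (there (here refl)) (here refl)

  greedy₁ : ∃[ G ] Basis M G × PrefixTight M L₁ G
  greedy₁ = greedy-basis M L₁ covers₁

  greedy₂ : ∃[ G ] Basis M G × PrefixTight M L₂ G
  greedy₂ = greedy-basis M L₂ covers₂

  G₁ G₂ : Subset n
  G₁ = proj₁ greedy₁
  G₂ = proj₁ greedy₂

  G₁-basis : Basis M G₁
  G₁-basis = proj₁ (proj₂ greedy₁)

  G₂-basis : Basis M G₂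
  G₂-basis = proj₁ (proj₂ greedy₂)

  G₁-prefixTight : PrefixTight M L₁ G₁
  G₁-prefixTight = proj₂ (proj₂ greedy₁)

  G₂-prefixTight : PrefixTight M L₂ G₂
  G₂-prefixTight = proj₂ (proj₂ greedy₂)

  G₁-optimal : ∀ {x} → InThisCone x → ∀ B → Basis M B → weight x B ℚ.≤ weight x G₁
  G₁-optimal {x} x∈cone = greedy-optimal M L₁-unique covers₁
    G₁-basis G₁-prefixTight x (cone⇒descending₁ x∈cone)

  G₂-optimal : ∀ {x} → InThisCone x → ∀ B → Basis M B → weight x B ℚ.≤ weight x G₂
  G₂-optimal {x} x∈cone = greedy-optimal M L₂-unique covers₂
    G₂-basis G₂-prefixTight x (cone⇒descending₂ x∈cone)

  cone⊆normalCone : ∀ x → InThisCone x → InNormalConeOfEdge M G₁ G₂ x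
  cone⊆normalCone x x∈cone =
    ℚₚ.≤-antisym (G₂-optimal x∈cone G₁ G₁-basis) (G₁-optimal x∈cone G₂ G₂-basis) , G₁-optimal x∈cone

  -- The prefixes of L₁ that do not separate i from j.
  data Cut : List (Fin n) → Set where
    within-K  : ∀ as cs → ks ≡ as ++ cs → Cut as
    beyond-ij : ∀ as cs → ls ≡ as ++ cs → Cut (ks ++ i ∷ j ∷ as)

  cut-prefix : ∀ {P} → Cut P → ∃[ Q ] L₁ ≡ P ++ Q
  cut-prefix (within-K as cs ks≡as++cs) =
    cs ++ i ∷ j ∷ ls , trans (cong (_++ i ∷ j ∷ ls) ks≡as++cs) (Listₚ.++-assoc as cs _)
  cut-prefix (beyond-ij as cs ls≡as++cs) =
    cs , trans (cong (λ z → ks ++ i ∷ j ∷ z) ls≡as++cs) (sym (Listₚ.++-assoc ks (i ∷ j ∷ as) cs))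

  SameSide : Subset n → Set
  SameSide T = (i ∈ T × j ∈ T) ⊎ (i ∉ T × j ∉ T)

  cut-sameSide : ∀ {P} → Cut P → SameSide (fromList P)
  cut-sameSide (within-K as cs ks≡as++cs) = inj₂ (∉as i∉K , ∉as j∉K)
    where
    ∉as : ∀ {e} → e ∉ K → e ∉ fromList as
    ∉as e∉K e∈as = e∉K (∈ks⇒∈K (subst (_ ∈ₗ_) (sym ks≡as++cs) (∈-++⁺ˡ (∈-fromList⁻ {L = as} e∈as))))
  cut-sameSide (beyond-ij as cs _) =
    inj₁ (∈-fromList⁺ (∈-++⁺ʳ ks (here refl)) , ∈-fromList⁺ (∈-++⁺ʳ ks (there (here refl))))

  sameSide-∁ : ∀ {T} → SameSide T → SameSide (∁ T)
  sameSide-∁ (inj₁ (i∈T , j∈T)) = inj₂ (x∈p⇒x∉∁p i∈T , x∈p⇒x∉∁p j∈T)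
  sameSide-∁ (inj₂ (i∉T , j∉T)) = inj₁ (x∉p⇒x∈∁p i∉T , x∉p⇒x∈∁p j∉T)

  sameSide⇒indicator≡ : ∀ {T} → SameSide T → indicator T i ≡ indicator T j
  sameSide⇒indicator≡ (inj₁ (i∈T , j∈T)) = trans (indicator-∈ i∈T) (sym (indicator-∈ j∈T))
  sameSide⇒indicator≡ (inj₂ (i∉T , j∉T)) = trans (indicator-∉ i∉T) (sym (indicator-∉ j∉T))

  cut-indicator∈cone : ∀ {P} → Cut P → InThisCone (indicator (fromList P))
  cut-indicator∈cone {P} cut =
    descending-delete ks (subst (Descending _) (sym L₁≡P++Q)
      (prefix-indicator-descending P (subst Unique L₁≡P++Q L₁-unique))) ,
    sameSide⇒indicator≡ (cut-sameSide cut)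
    where
    L₁≡P++Q : L₁ ≡ P ++ proj₁ (cut-prefix cut)
    L₁≡P++Q = proj₂ (cut-prefix cut)

  record TightOnCuts (B : Subset n) : Set where
    constructor tightOnCuts
    field
      tightAt : ∀ {P} → Cut P → Tight M B (fromList P)
  open TightOnCuts

  G₁-tightOnCuts : TightOnCuts G₁
  G₁-tightOnCuts = tightOnCuts λ cut → G₁-prefixTight _ (proj₁ (cut-prefix cut)) (proj₂ (cut-prefix cut))

  cuts-around : ∀ {e} → e ≢ i → e ≢ j → ∃[ P ] ∃[ Q ] (L₁ ≡ P ++ e ∷ Q × Cut P × Cut (P ++ e ∷ []))
  cuts-around {e} e≢i e≢j with e ∈? K
  ... | yes e∈K =
    let (as , cs , ks≡as++e∷cs) = ∈-∃++ (∈K⇒∈ks e∈K) in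
    as , cs ++ i ∷ j ∷ ls ,
    trans (cong (_++ i ∷ j ∷ ls) ks≡as++e∷cs) (Listₚ.++-assoc as (e ∷ cs) _) ,
    within-K as (e ∷ cs) ks≡as++e∷cs ,
    within-K (as ++ e ∷ []) cs (trans ks≡as++e∷cs (sym (Listₚ.++-assoc as (e ∷ []) cs)))
  ... | no e∉K =
    let (as , cs , ls≡as++e∷cs) = ∈-∃++ (∉ijK⇒∈ls (λ e∈ → e∉K (∈ijK∖ij⇒∈K e∈ e≢i e≢j))) in
    ks ++ i ∷ j ∷ as , cs ,
    trans (cong (λ z → ks ++ i ∷ j ∷ z) ls≡as++e∷cs) (sym (Listₚ.++-assoc ks (i ∷ j ∷ as) (e ∷ cs))) ,
    beyond-ij as (e ∷ cs) ls≡as++e∷cs ,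
    subst Cut (sym (Listₚ.++-assoc ks (i ∷ j ∷ as) (e ∷ [])))
      (beyond-ij (as ++ e ∷ []) cs (trans ls≡as++e∷cs (sym (Listₚ.++-assoc as (e ∷ []) cs))))

  -- Consecutive cuts differ by a single element e, which tightness of both forces into or out of B.
  tightOnCuts-⊆ : ∀ {B B′} → TightOnCuts B → TightOnCuts B′ →
    (i ∈ B → i ∈ B′) → (j ∈ B → j ∈ B′) → B ⊆ B′
  tightOnCuts-⊆ {B} {B′} B-tight B′-tight i⇒ j⇒ {e} e∈B with e Fin.≟ i | e Fin.≟ j
  ... | yes refl | _        = i⇒ e∈B
  ... | no  _    | yes refl = j⇒ e∈B
  ... | no  e≢i  | no  e≢j  with cuts-around e≢i e≢j
  ...   | P , Q , L₁≡P++e∷Q , cut , cut+e =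
    agree-on-new-element (unique⇒∉suffix P (subst Unique L₁≡P++e∷Q L₁-unique) (here refl))
      (trans (tightAt B-tight cut) (sym (tightAt B′-tight cut)))
      (subst (λ T → ∣ B ∩ T ∣ ≡ ∣ B′ ∩ T ∣) (fromList-∷ʳ P e)
        (trans (tightAt B-tight cut+e) (sym (tightAt B′-tight cut+e))))
      e∈B

  K-cut : Cut ks
  K-cut = within-K ks [] (sym (Listₚ.++-identityʳ ks))

  ijK-cut : Cut (ks ++ i ∷ j ∷ [])
  ijK-cut = beyond-ij [] ls refl

  tight-K : ∀ {B} → TightOnCuts B → ∣ B ∩ K ∣ ≡ r K
  tight-K {B} B-tight = subst (Tight M B) fromList-ks (tightAt B-tight K-cut)

  tight-ijK : ∀ {B} → TightOnCuts B → ∣ B ∩ ijK ∣ ≡ r ijK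
  tight-ijK {B} B-tight = subst (Tight M B) fromList-ks++ij (tightAt B-tight ijK-cut)
    where
    fromList-ks++ij : fromList (ks ++ i ∷ j ∷ []) ≡ ijK
    fromList-ks++ij = trans (fromList-++ ks (i ∷ j ∷ [])) (trans (cong (_∪ _) fromList-ks)
      (solve 3 (λ k a b → k ⊕ (a ⊕ (b ⊕ id)) ⊜ a ⊕ (b ⊕ k)) refl K ⁅ i ⁆ ⁅ j ⁆))
      where open ∪-Solver

  ∣∩⁅a⁆∪K∣ : ∀ B {a} → a ∉ K → ∣ B ∩ (⁅ a ⁆ ∪ K) ∣ ≡ ∣ B ∩ K ∣ + ∣ B ∩ ⁅ a ⁆ ∣
  ∣∩⁅a⁆∪K∣ B {a} a∉K = trans (cong (λ T → ∣ B ∩ T ∣) (⁅a⁆∪K≡K∪⁅a⁆ a)) (x∉q⇒∣p∩q∪⁅x⁆∣≡∣p∩q∣+∣p∩⁅x⁆∣ B a∉K)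

  j∉iK : j ∉ iK
  j∉iK j∈iK with x∈p∪q⁻ ⁅ i ⁆ K j∈iK
  ... | inj₁ j∈⁅i⁆ = i≢j (sym (x∈⁅y⁆⇒x≡y i j∈⁅i⁆))
  ... | inj₂ j∈K   = j∉K j∈K

  i∉jK : i ∉ jK
  i∉jK i∈jK with x∈p∪q⁻ ⁅ j ⁆ K i∈jK
  ... | inj₁ i∈⁅j⁆ = i≢j (x∈⁅y⁆⇒x≡y j i∈⁅j⁆)
  ... | inj₂ i∈K   = i∉K i∈K

  ∣∩ijK∣ : ∀ B → ∣ B ∩ ijK ∣ ≡ (∣ B ∩ K ∣ + ∣ B ∩ ⁅ i ⁆ ∣) + ∣ B ∩ ⁅ j ⁆ ∣
  ∣∩ijK∣ B = begin
    ∣ B ∩ ijK ∣                                  ≡⟨ cong (λ T → ∣ B ∩ T ∣) ijK≡iK∪⁅j⁆ ⟩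
    ∣ B ∩ (iK ∪ ⁅ j ⁆) ∣                         ≡⟨ x∉q⇒∣p∩q∪⁅x⁆∣≡∣p∩q∣+∣p∩⁅x⁆∣ B j∉iK ⟩
    ∣ B ∩ iK ∣ + ∣ B ∩ ⁅ j ⁆ ∣                   ≡⟨ cong (_+ ∣ B ∩ ⁅ j ⁆ ∣) (∣∩⁅a⁆∪K∣ B i∉K) ⟩
    (∣ B ∩ K ∣ + ∣ B ∩ ⁅ i ⁆ ∣) + ∣ B ∩ ⁅ j ⁆ ∣  ∎
    where open ≡-Reasoning

  tightOnCuts⇒r-ijK : ∀ {B} → TightOnCuts B → (r K + ∣ B ∩ ⁅ i ⁆ ∣) + ∣ B ∩ ⁅ j ⁆ ∣ ≡ r ijK
  tightOnCuts⇒r-ijK {B} B-tight = begin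
    (r K + ∣ B ∩ ⁅ i ⁆ ∣) + ∣ B ∩ ⁅ j ⁆ ∣        ≡⟨ cong (λ k → (k + ∣ B ∩ ⁅ i ⁆ ∣) + ∣ B ∩ ⁅ j ⁆ ∣) (tight-K B-tight) ⟨
    (∣ B ∩ K ∣ + ∣ B ∩ ⁅ i ⁆ ∣) + ∣ B ∩ ⁅ j ⁆ ∣  ≡⟨ ∣∩ijK∣ B ⟨
    ∣ B ∩ ijK ∣                                  ≡⟨ tight-ijK B-tight ⟩
    r ijK                                        ∎
    where open ≡-Reasoning

  one-of-ij : ∀ {B} → TightOnCuts B → r ijK ≡ suc (r K) → (i ∈ B → j ∉ B) × (i ∉ B → j ∈ B)
  one-of-ij {B} B-tight r-ijK =
    (λ i∈B → ∣p∩⁅x⁆∣≡0⇒x∉p (ℕₚ.+-cancelˡ-≡ 1 _ _ (trans (cong (_+ ∣ B ∩ ⁅ j ⁆ ∣) (sym (x∈p⇒∣p∩⁅x⁆∣≡1 i∈B))) one))) ,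
    (λ i∉B → ∣p∩⁅x⁆∣≡1⇒x∈p (trans (cong (_+ ∣ B ∩ ⁅ j ⁆ ∣) (sym (x∉p⇒∣p∩⁅x⁆∣≡0 i∉B))) one))
    where
    one : ∣ B ∩ ⁅ i ⁆ ∣ + ∣ B ∩ ⁅ j ⁆ ∣ ≡ 1
    one = ℕₚ.+-cancelˡ-≡ (r K) _ _ (trans (sym (ℕₚ.+-assoc (r K) _ _))
            (trans (tightOnCuts⇒r-ijK B-tight) (trans r-ijK (ℕₚ.+-comm 1 (r K)))))

  greedy-picks : ∀ {G a b} → PrefixTight M (ks ++ a ∷ b ∷ ls) G → a ∉ K → b ∉ ⁅ a ⁆ ∪ K →
    r (⁅ a ⁆ ∪ K) ≡ suc (r K) → r ((⁅ a ⁆ ∪ K) ∪ ⁅ b ⁆) ≡ suc (r K) → a ∈ G × b ∉ G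
  greedy-picks {G} {a} {b} tight a∉K b∉aK r-aK r-aKb =
    ∣p∩⁅x⁆∣≡1⇒x∈p (ℕₚ.+-cancelˡ-≡ (r K) _ _ (begin
      r K + ∣ G ∩ ⁅ a ⁆ ∣         ≡⟨ cong (_+ ∣ G ∩ ⁅ a ⁆ ∣) G-tight-K ⟨
      ∣ G ∩ K ∣ + ∣ G ∩ ⁅ a ⁆ ∣   ≡⟨ ∣∩⁅a⁆∪K∣ G a∉K ⟨
      ∣ G ∩ (⁅ a ⁆ ∪ K) ∣         ≡⟨ trans G-tight-aK r-aK ⟩
      suc (r K)                   ≡⟨ ℕₚ.+-comm 1 (r K) ⟩
      r K + 1                     ∎)) ,
    ∣p∩⁅x⁆∣≡0⇒x∉p (ℕₚ.+-cancelˡ-≡ (suc (r K)) _ _ (begin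
      suc (r K) + ∣ G ∩ ⁅ b ⁆ ∣               ≡⟨ cong (_+ ∣ G ∩ ⁅ b ⁆ ∣) (trans G-tight-aK r-aK) ⟨
      ∣ G ∩ (⁅ a ⁆ ∪ K) ∣ + ∣ G ∩ ⁅ b ⁆ ∣     ≡⟨ x∉q⇒∣p∩q∪⁅x⁆∣≡∣p∩q∣+∣p∩⁅x⁆∣ G b∉aK ⟨
      ∣ G ∩ ((⁅ a ⁆ ∪ K) ∪ ⁅ b ⁆) ∣           ≡⟨ trans G-tight-aKb r-aKb ⟩
      suc (r K)                               ≡⟨ ℕₚ.+-identityʳ (suc (r K)) ⟨
      suc (r K) + 0                           ∎))
    where
    open ≡-Reasoning
    fromList-ks+a : fromList (ks ++ a ∷ []) ≡ ⁅ a ⁆ ∪ K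
    fromList-ks+a = trans (fromList-∷ʳ ks a) (trans (cong (_∪ ⁅ a ⁆) fromList-ks) (sym (⁅a⁆∪K≡K∪⁅a⁆ a)))
    G-tight-K : ∣ G ∩ K ∣ ≡ r K
    G-tight-K = subst (Tight M G) fromList-ks (tight ks (a ∷ b ∷ ls) refl)
    G-tight-aK : ∣ G ∩ (⁅ a ⁆ ∪ K) ∣ ≡ r (⁅ a ⁆ ∪ K)
    G-tight-aK = subst (Tight M G) fromList-ks+a
      (tight (ks ++ a ∷ []) (b ∷ ls) (sym (Listₚ.++-assoc ks (a ∷ []) (b ∷ ls))))
    G-tight-aKb : ∣ G ∩ ((⁅ a ⁆ ∪ K) ∪ ⁅ b ⁆) ∣ ≡ r ((⁅ a ⁆ ∪ K) ∪ ⁅ b ⁆)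
    G-tight-aKb = subst (Tight M G)
      (trans (cong fromList (sym (Listₚ.++-assoc ks (a ∷ []) (b ∷ []))))
             (trans (fromList-∷ʳ (ks ++ a ∷ []) b) (cong (_∪ ⁅ b ⁆) fromList-ks+a)))
      (tight (ks ++ a ∷ b ∷ []) ls (sym (Listₚ.++-assoc ks (a ∷ b ∷ []) ls)))

  merge-j-into-i : Fin n → Fin n
  merge-j-into-i e with e Fin.≟ j
  ... | yes _ = i
  ... | no  _ = e

  merge-j : merge-j-into-i j ≡ i
  merge-j with j Fin.≟ j
  ... | yes _   = refl
  ... | no  j≢j = ⊥-elim (j≢j refl)

  merge-≢j : ∀ {e} → e ≢ j → merge-j-into-i e ≡ e
  merge-≢j {e} e≢j with e Fin.≟ j
  ... | yes e≡j = ⊥-elim (e≢j e≡j)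
  ... | no  _   = refl

  -- The functional exposing the edge [G₁, G₂].
  y : Fin n → ℚ
  y e = height L₀ (merge-j-into-i e) · 1ℚ

  y-steep : Linked (λ a b → y b ℚ.+ 1ℚ ℚ.≤ y a) L₀
  y-steep = linked-map-All step (All.tabulate L₀∌j) (height-descending L₀ L₀-unique)
    where
    L₀∌j : ∀ {e} → e ∈ₗ L₀ → e ≢ j
    L₀∌j e∈L₀ refl with ∈-++⁻ ks e∈L₀
    ... | inj₁ j∈ks          = j∉K (∈ks⇒∈K j∈ks)
    ... | inj₂ (here j≡i)    = i≢j (sym j≡i)
    ... | inj₂ (there j∈ls)  = ∈ls⇒∉ijK j∈ls j∈ijK
    step : ∀ {a b} → a ≢ j → b ≢ j → suc (height L₀ b) ≤ height L₀ a → y b ℚ.+ 1ℚ ℚ.≤ y a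
    step {a} {b} a≢j b≢j hb<ha = subst₂ ℚ._≤_
      (trans (ℚₚ.+-comm 1ℚ (height L₀ b · 1ℚ)) (cong (λ e → height L₀ e · 1ℚ ℚ.+ 1ℚ) (sym (merge-≢j b≢j))))
      (cong (λ e → height L₀ e · 1ℚ) (sym (merge-≢j a≢j)))
      (·1-mono-≤ hb<ha)

  yi≡yj : y i ≡ y j
  yi≡yj = cong (λ e → height L₀ e · 1ℚ) (trans (merge-≢j i≢j) (sym merge-j))

  y∈cone : InThisCone y
  y∈cone = Linked.map (λ {a} {b} → ℚₚ.≤-trans (y≤y+1 b)) y-steep , yi≡yj
    where
    y≤y+1 : ∀ e → y e ℚ.≤ y e ℚ.+ 1ℚ
    y≤y+1 e = subst (ℚ._≤ y e ℚ.+ 1ℚ) (ℚₚ.+-identityʳ (y e)) (ℚₚ.+-monoʳ-≤ (y e) 0≤1)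

  -- Perturbing y by the indicator of ∁ T keeps it in the cone, so its maximiser G₁ bounds |B ∩ ∁ T|.
  y-maximizer⇒tightOnCuts : ∀ {B} → Basis M B → weight y B ≡ weight y G₁ → TightOnCuts B
  y-maximizer⇒tightOnCuts {B} B-basis wB≡wG₁ = tightOnCuts tight-at
    where
    tight-at : ∀ {P} → Cut P → Tight M B (fromList P)
    tight-at {P} cut =
      tight-if-complement-≤ M {G = G₁} B-basis G₁-basis (tightAt G₁-tightOnCuts cut)
        (·1-cancel-≤ _ _ (+-cancelˡ-≤ (weight y G₁) (begin
          weight y G₁ ℚ.+ ∣ B ∩ ∁ T ∣ · 1ℚ     ≡⟨ cong (ℚ._+ ∣ B ∩ ∁ T ∣ · 1ℚ) wB≡wG₁ ⟨
          weight y B ℚ.+ ∣ B ∩ ∁ T ∣ · 1ℚ      ≡⟨ weight-y′ B ⟨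
          weight y′ B                          ≤⟨ G₁-optimal y′∈cone B B-basis ⟩
          weight y′ G₁                         ≡⟨ weight-y′ G₁ ⟩
          weight y G₁ ℚ.+ ∣ G₁ ∩ ∁ T ∣ · 1ℚ    ∎)))
      where
      open ℚₚ.≤-Reasoning
      T : Subset n
      T = fromList P
      y′ : Fin n → ℚ
      y′ e = y e ℚ.+ indicator (∁ T) e
      y′∈cone : InThisCone y′
      y′∈cone = descending-+ y-steep (0≤indicator (∁ T)) (indicator≤1 (∁ T)) ,
                cong₂ ℚ._+_ yi≡yj (sameSide⇒indicator≡ (sameSide-∁ (cut-sameSide cut)))
      weight-y′ : ∀ X → weight y′ X ≡ weight y X ℚ.+ ∣ X ∩ ∁ T ∣ · 1ℚ
      weight-y′ X = trans (weight-+ y (indicator (∁ T)) X) (cong (weight y X ℚ.+_) (weight-indicator (∁ T) X))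

  ranksJump⇒edge : RanksJump → Edge M G₁ G₂
  ranksJump⇒edge (r-iK , r-jK , r-ijK) =
    G₁-basis , G₂-basis , G₁≢G₂ , y , wG₁≡wG₂ , G₁-optimal y∈cone , y-maximizers
    where
    G₁-picks : i ∈ G₁ × j ∉ G₁
    G₁-picks = greedy-picks G₁-prefixTight i∉K j∉iK r-iK (trans (cong r (sym ijK≡iK∪⁅j⁆)) r-ijK)
    G₂-picks : j ∈ G₂ × i ∉ G₂
    G₂-picks = greedy-picks G₂-prefixTight j∉K i∉jK r-jK (trans (cong r (sym ijK≡jK∪⁅i⁆)) r-ijK)
    G₁≢G₂ : G₁ ≢ G₂
    G₁≢G₂ G₁≡G₂ = proj₂ G₁-picks (subst (j ∈_) (sym G₁≡G₂) (proj₁ G₂-picks))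
    wG₁≡wG₂ : weight y G₁ ≡ weight y G₂
    wG₁≡wG₂ = proj₁ (cone⊆normalCone y y∈cone)
    G₂-tightOnCuts : TightOnCuts G₂
    G₂-tightOnCuts = y-maximizer⇒tightOnCuts G₂-basis (sym wG₁≡wG₂)
    y-maximizers : ∀ B → Basis M B → weight y B ≡ weight y G₁ → B ≡ G₁ ⊎ B ≡ G₂
    y-maximizers B B-basis wB≡wG₁ with i ∈? B
    ... | yes i∈B = inj₁ (⊆-antisym
      (tightOnCuts-⊆ B-tight G₁-tightOnCuts (λ _ → proj₁ G₁-picks) (⊥-elim ∘ proj₁ (one-of-ij B-tight r-ijK) i∈B))
      (tightOnCuts-⊆ G₁-tightOnCuts B-tight (λ _ → i∈B) (⊥-elim ∘ proj₂ G₁-picks)))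
      where B-tight = y-maximizer⇒tightOnCuts B-basis wB≡wG₁
    ... | no  i∉B = inj₂ (⊆-antisym
      (tightOnCuts-⊆ B-tight G₂-tightOnCuts (⊥-elim ∘ i∉B) (λ _ → proj₁ G₂-picks))
      (tightOnCuts-⊆ G₂-tightOnCuts B-tight (⊥-elim ∘ proj₂ G₂-picks) (λ _ → proj₂ (one-of-ij B-tight r-ijK) i∉B)))
      where B-tight = y-maximizer⇒tightOnCuts B-basis wB≡wG₁

  indicator-maximizer⇒tightOnCuts : ∀ {B} → Basis M B →
    (∀ {P} → Cut P → weight (indicator (fromList P)) G₁ ℚ.≤ weight (indicator (fromList P)) B) → TightOnCuts B
  indicator-maximizer⇒tightOnCuts {B} (_ , B-indep , _) maximizes = tightOnCuts λ {P} cut →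
    tight-if-≥-tight M {G = G₁} B-indep (tightAt G₁-tightOnCuts cut)
      (·1-cancel-≤ _ _ (subst₂ ℚ._≤_ (weight-indicator (fromList P) G₁) (weight-indicator (fromList P) B) (maximizes cut)))

  bracket⇒counts : InBracket M i j K → ∀ {B} → Independent M B → TightOnCuts B →
    r K + ∣ B ∩ ⁅ i ⁆ ∣ ≡ r iK × r K + ∣ B ∩ ⁅ j ⁆ ∣ ≡ r jK
  bracket⇒counts bracket {B} B-indep B-tight =
    m≤o⇒n≤p⇒m+n≡o+p⇒m≡o (bound i∉K) (bound j∉K) total ,
    m≤o⇒n≤p⇒m+n≡o+p⇒m≡o (bound j∉K) (bound i∉K)
      (trans (ℕₚ.+-comm (r K + χ j) (r K + χ i)) (trans total (ℕₚ.+-comm (r iK) (r jK))))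
    where
    χ : Fin n → ℕ
    χ a = ∣ B ∩ ⁅ a ⁆ ∣
    bound : ∀ {a} → a ∉ K → r K + χ a ≤ r (⁅ a ⁆ ∪ K)
    bound {a} a∉K = subst (_≤ r (⁅ a ⁆ ∪ K)) (trans (∣∩⁅a⁆∪K∣ B a∉K) (cong (_+ χ a) (tight-K B-tight)))
      (independent⇒∣∩∣≤r M (⁅ a ⁆ ∪ K) B-indep)
    total : (r K + χ i) + (r K + χ j) ≡ r iK + r jK
    total = begin
      (r K + χ i) + (r K + χ j)  ≡⟨ solve 3 (λ k a b → (k :+ a) :+ (k :+ b) := ((k :+ a) :+ b) :+ k) refl (r K) (χ i) (χ j) ⟩
      ((r K + χ i) + χ j) + r K  ≡⟨ cong (_+ r K) (tightOnCuts⇒r-ijK B-tight) ⟩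
      r ijK + r K                ≡⟨ bracket ⟨
      r iK + r jK                ∎
      where
      open ≡-Reasoning
      open +-*-Solver

  edge⇒¬bracket : ∀ {B₁ B₂} → Edge M B₁ B₂ → (∀ x → InThisCone x → InNormalConeOfEdge M B₁ B₂ x) →
    ¬ InBracket M i j K
  edge⇒¬bracket {B₁} {B₂} (B₁-basis , B₂-basis , B₁≢B₂ , _) cone⊆normal bracket =
    B₁≢B₂ (⊆-antisym B₁⊆B₂ B₂⊆B₁)
    where
    normal : ∀ {P} → Cut P → InNormalConeOfEdge M B₁ B₂ (indicator (fromList P))
    normal cut = cone⊆normal _ (cut-indicator∈cone cut)
    B₁-tight : TightOnCuts B₁
    B₁-tight = indicator-maximizer⇒tightOnCuts B₁-basis λ cut → proj₂ (normal cut) G₁ G₁-basis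
    B₂-tight : TightOnCuts B₂
    B₂-tight = indicator-maximizer⇒tightOnCuts B₂-basis λ cut →
      subst (weight _ G₁ ℚ.≤_) (proj₁ (normal cut)) (proj₂ (normal cut) G₁ G₁-basis)
    counts₁ : r K + ∣ B₁ ∩ ⁅ i ⁆ ∣ ≡ r iK × r K + ∣ B₁ ∩ ⁅ j ⁆ ∣ ≡ r jK
    counts₁ = bracket⇒counts bracket (proj₁ (proj₂ B₁-basis)) B₁-tight
    counts₂ : r K + ∣ B₂ ∩ ⁅ i ⁆ ∣ ≡ r iK × r K + ∣ B₂ ∩ ⁅ j ⁆ ∣ ≡ r jK
    counts₂ = bracket⇒counts bracket (proj₁ (proj₂ B₂-basis)) B₂-tight
    same-i : ∣ B₁ ∩ ⁅ i ⁆ ∣ ≡ ∣ B₂ ∩ ⁅ i ⁆ ∣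
    same-i = ℕₚ.+-cancelˡ-≡ (r K) _ _ (trans (proj₁ counts₁) (sym (proj₁ counts₂)))
    same-j : ∣ B₁ ∩ ⁅ j ⁆ ∣ ≡ ∣ B₂ ∩ ⁅ j ⁆ ∣
    same-j = ℕₚ.+-cancelˡ-≡ (r K) _ _ (trans (proj₂ counts₁) (sym (proj₂ counts₂)))
    B₁⊆B₂ : B₁ ⊆ B₂
    B₁⊆B₂ = tightOnCuts-⊆ B₁-tight B₂-tight
      (∣p∩⁅x⁆∣≡∣q∩⁅x⁆∣⇒x∈p⇒x∈q same-i) (∣p∩⁅x⁆∣≡∣q∩⁅x⁆∣⇒x∈p⇒x∈q same-j)
    B₂⊆B₁ : B₂ ⊆ B₁
    B₂⊆B₁ = tightOnCuts-⊆ B₂-tight B₁-tight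
      (∣p∩⁅x⁆∣≡∣q∩⁅x⁆∣⇒x∈p⇒x∈q (sym same-i)) (∣p∩⁅x⁆∣≡∣q∩⁅x⁆∣⇒x∈p⇒x∈q (sym same-j))

ranksJump⇔coneCondition : ∀ {n} (M : Matroid n) K (i j : Fin n) (i≢j : i ≢ j) (i∉K : i ∉ K) (j∉K : j ∉ K) →
  Local.RanksJump M K i j i≢j i∉K j∉K ⇔ ConeCondition M i j K
ranksJump⇔coneCondition M K i j i≢j i∉K j∉K = mk⇔
  (λ jumps ks ls ks-orders ls-orders → let open Cone M K i j i≢j i∉K j∉K ks ls ks-orders ls-orders in
    G₁ , G₂ , ranksJump⇒edge jumps , cone⊆normalCone)
  (λ cone-condition → ¬bracket⇒ranksJump λ bracket →
    let open Cone M K i j i≢j i∉K j∉K (toList K) (toList (∁ ijK)) (toList-orders M K) (toList-orders M (∁ ijK))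
        (_ , _ , edge , cone⊆normal) = cone-condition _ _ (toList-orders M K) (toList-orders M (∁ ijK))
    in edge⇒¬bracket edge cone⊆normal bracket)
  where open Local M K i j i≢j i∉K j∉K

proposition2p3 : ∀ {n} (M : Matroid n) (K : Subset n) (i j : Fin n) →
  i ≢ j → i ∉ K → j ∉ K →
  let open Matroid M
      iK = ⁅ i ⁆ ∪ K
      jK = ⁅ j ⁆ ∪ K
      ijK = ⁅ i ⁆ ∪ ⁅ j ⁆ ∪ K
      c1 = ¬ InBracket M i j K
      c2 = (r iK ≡ r jK) × (r jK ≡ r ijK) × (r ijK ≡ suc (r K))
      c3 = (∃[ C ] (Circuit M C × i ∈ C × j ∈ C × C ⊆ ijK))
           × (∀ C → Circuit M C → C ⊆ ijK → (i ∈ C × j ∈ C) ⊎ (i ∉ C × j ∉ C))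
      c4 = CocircuitOf M ijK (⁅ i ⁆ ∪ ⁅ j ⁆)
      c4′ = HyperplaneOf M ijK K
      c5 = ∀ B → BasisOf M K B → BasisOf M ijK (⁅ i ⁆ ∪ B) × BasisOf M ijK (⁅ j ⁆ ∪ B)
      c6 = ∃[ B ] (BasisOf M K B × BasisOf M ijK (⁅ i ⁆ ∪ B) × BasisOf M ijK (⁅ j ⁆ ∪ B))
      c7 = ConeCondition M i j K
  in (c1 ⇔ c2) × (c1 ⇔ c3) × (c1 ⇔ c4) × (c1 ⇔ c4′)
     × (c1 ⇔ c5) × (c1 ⇔ c6) × (c1 ⇔ c7)
proposition2p3 M K i j i≢j i∉K j∉K =
  via ranksJump⇔chain , via ranksJump⇔circuits , via ranksJump⇔cocircuit , via ranksJump⇔hyperplane ,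
  via ranksJump⇔extendsEvery , via ranksJump⇔extendsSome , via (ranksJump⇔coneCondition M K i j i≢j i∉K j∉K)
  where
  open Local M K i j i≢j i∉K j∉K
  via : ∀ {P : Set} → RanksJump ⇔ P → (¬ InBracket M i j K) ⇔ P
  via = Equivalence.trans ¬bracket⇔ranksJump
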